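{- Let $D$ be a non-crossing diagram on $n+1$ strings of size $p$, and write $\mathcal I(D)=\{i_1,\dots,i_p\}$ with $i_1>\cdots>i_p$ and $\mathcal J(D)=\{j_1,\dots,j_p\}$ with $j_1>\cdots>j_p$. Then $i_k\le j_k$ for all $1\le k\le p$, and $D=\mathcal D(w_D)$ where $w_D=[i_1,j_1][i_2,j_2]\cdots[i_p,j_p]$ is a fully commutative element of $W(A_n)$ (in canonical form).
   Context: $W(A_n)$: Coxeter group on $\sigma_1,\dots,\sigma_n$ of type $A_n$; FC = fully commutative (reduced expressions related by commutations only); $[i,j]=\sigma_i\cdots\sigma_j$; every FC element has a unique canonical form $[i_1,j_1]\cdots[i_p,j_p]$ with $n\ge j_1>\cdots>j_p\ge1$, $n\ge i_1>\cdots>i_p\ge 1$, $j_t\ge i_t$. A non-crossing diagram on $n+1$ strings has top dots $A=\{1,\dots,n+1\}$, bottom dots $B=\{1',\dots,(n+1)'\}$, each dot joined to exactly one other, joins non-crossing. Order $1<\cdots<n+1<1'<\cdots<(n+1)'$; a join is an arrow $(x,y)$, $x<y$, tail $x$, head $y$. $AD$ = arrows with both ends in $A$, $BD$ = arrows with both ends in $B$, $D^+$ = arrows $(x,y')$ with $x,y\in A$, $x<y$. $\mathcal I(D)$ = tails of arrows of $AD\cup D^+$; $\mathcal J(D)=\{j\in A:(j+1)'$ is a head of an arrow in $BD\cup D^+\}$. The size of $D$ is $\#(AD\cup D^+)$. Concatenation $D_1\ast D_2$: stack $D_2$ below $D_1$, follow paths, delete closed circles; $E_i$ has arrows $(i,i+1),(i',(i+1)')$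 and $(j,j')$, $j\neq i,i+1$. For FC $w$ in canonical form, $\mathcal D(w)=E_{i_1}\ast E_{i_1+1}\ast\cdots\ast E_{j_1}\ast\cdots\ast E_{i_p}\ast\cdots\ast E_{j_p}$ (identity diagram if $p=0$). -}

module Defs where

open import Data.Nat using (ℕ; zero; suc; _+_; _*_; _∸_; _≤_; _<_; _<ᵇ_; pred)
open import Data.Fin using (Fin; zero; suc; toℕ)
open import Data.Bool using (Bool)
open import Data.Maybe using (Maybe; just; nothing; maybe)
import Data.Maybe as Maybe
open import Data.List using (List; []; _∷_; _++_; map; upTo; allFin; reverse; filterᵇ; length; zipWith; concat; foldl)
open import Data.List.Relation.Unary.All using (All)
open import Data.Product using (_×_; Σ)
open import Data.Sum using (_⊎_)
open import Relation.Binary.PropositionalEquality using (_≡_; _≢_)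
open import Relation.Nullary using (¬_)

-- Non-crossing diagrams on m strings.
-- Top dot  top x  has paper label  toℕ x + 1  (so x : Fin m stands for x+1 ∈ A),
-- bottom dot  bot x  has paper label  (toℕ x + 1)'.

data Dot (m : ℕ) : Set where
  top : Fin m → Dot m
  bot : Fin m → Dot m

-- position when walking around the boundary of the rectangle:
-- top dots left to right, then bottom dots right to left
pos : ∀ {m} → Dot m → ℕ
pos     (top x) = toℕ x
pos {m} (bot x) = (m + m ∸ 1) ∸ toℕ x

-- the joins of a diagram are given by a fixed-point-free involution
-- (each dot joined to exactly one other dot), and no two joins cross
record Diagram (m : ℕ) : Set where
  field
    match    : Dot m → Dot m
    involut  : ∀ x → match (match x) ≡ x
    nofix    : ∀ x → match x ≢ x
    noncross : ∀ a c → ¬ (pos a < pos c × pos c < pos (match a) × pos (match a) < pos (match c))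
open Diagram public

-- top x is the tail of an arrow of AD ∪ D⁺ : joined to top z or bot z with x < z
isTailB : ∀ {m} → (Dot m → Dot m) → Fin m → Bool
isTailB f x with f (top x)
... | top z = toℕ x <ᵇ toℕ z
... | bot z = toℕ x <ᵇ toℕ z

-- bot y is the head of an arrow of BD ∪ D⁺ : joined to bot z or top z with z < y
isHeadB : ∀ {m} → (Dot m → Dot m) → Fin m → Bool
isHeadB f y with f (bot y)
... | bot z = toℕ z <ᵇ toℕ y
... | top z = toℕ z <ᵇ toℕ y

-- 𝓘(D) as the list i₁ > i₂ > ⋯ > i_p of paper labels
Ilist : ∀ {m} → Diagram m → List ℕ
Ilist {m} D = map (λ x → suc (toℕ x)) (filterᵇ (isTailB (match D)) (reverse (allFin m)))

-- 𝓙(D) as the list j₁ > ⋯ > j_p : j ∈ 𝓙(D) iff (j+1)' (= bot y with toℕ y = j) is a head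
Jlist : ∀ {m} → Diagram m → List ℕ
Jlist {m} D = map toℕ (filterᵇ (isHeadB (match D)) (reverse (allFin m)))

-- size = #(AD ∪ D⁺) = number of tails of such arrows
size : ∀ {m} → Diagram m → ℕ
size {m} D = length (filterᵇ (isTailB (match D)) (allFin m))

-- Concatenation of (raw) diagrams: D₁ on top, D₂ below; paths are followed
-- through the middle row, closed circles disappear.  Fuel 2m+1 suffices
-- (each middle dot is passed at most once).

module _ {m : ℕ} (f g : Dot m → Dot m) where
  mutual
    -- entered D₂ at its top dot b (coming from above)
    goG : ℕ → Fin m → Dot m
    goG zero    b = top b   -- unreachable for genuine diagrams
    goG (suc k) b with g (top b)
    ... | bot c = bot c
    ... | top c = goF k c
    -- entered D₁ at its bottom dot c (coming from below)
    goF : ℕ → Fin m → Dot m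
    goF zero    c = top c   -- unreachable for genuine diagrams
    goF (suc k) c with f (bot c)
    ... | top d = top d
    ... | bot d = goG k d

  concatD : Dot m → Dot m
  concatD (top a) with f (top a)
  ... | top b = top b
  ... | bot b = goG (suc (m + m)) b
  concatD (bot a) with g (bot a)
  ... | bot c = bot c
  ... | top c = goF (suc (m + m)) c

-- partner of x under the adjacent pair {k, k+1} (0-indexed), if x is in it
nbr : ∀ {m} → ℕ → Fin m → Maybe (Fin m)
nbr {suc (suc m)} zero zero       = just (suc zero)
nbr {suc (suc m)} zero (suc zero) = just zero
nbr zero _ = nothing
nbr (suc k) zero = nothing
nbr {suc m} (suc k) (suc x) = Maybe.map suc (nbr k x)

-- E_i (paper label i ≥ 1): arrows (i,i+1), (i',(i+1)') and (j,j') for j ≠ i,i+1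
E : ∀ {m} → ℕ → Dot m → Dot m
E zero    x       = x
E (suc k) (top x) = maybe top (bot x) (nbr k x)
E (suc k) (bot x) = maybe bot (top x) (nbr k x)

-- 𝒟 of a word a₁ a₂ ⋯ a_r : E_{a₁} ∗ E_{a₂} ∗ ⋯ ∗ E_{a_r} (identity diagram (j,j') for the empty word)
𝒟 : ∀ {m} → List ℕ → Dot m → Dot m
𝒟 []      (top x) = bot x
𝒟 []      (bot x) = top x
𝒟 (a ∷ u) = concatD (E a) (𝒟 u)

-- [i,j] = σ_i σ_{i+1} ⋯ σ_j
interval : ℕ → ℕ → List ℕ
interval i j = map (i +_) (upTo (suc (j ∸ i)))

canonWord : List ℕ → List ℕ → List ℕ
canonWord is js = concat (zipWith interval is js)

ValidWord : ℕ → List ℕ → Set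
ValidWord n u = All (λ a → 1 ≤ a × a ≤ n) u

swapAt : ℕ → List ℕ → List ℕ
swapAt zero    (a ∷ b ∷ xs) = b ∷ a ∷ xs
swapAt zero    xs           = xs
swapAt (suc k) []           = []
swapAt (suc k) (a ∷ xs)     = a ∷ swapAt k xs

-- the element of W(A_n) ≅ S_{n+1} represented by a word (one-line notation);
-- σ_i acts as the transposition of positions i, i+1
perm : ℕ → List ℕ → List ℕ
perm n u = foldl (λ l a → swapAt (pred a) l) (map suc (upTo (suc n))) u

Reduced : ℕ → List ℕ → Set
Reduced n u = ValidWord n u × (∀ v → ValidWord n v → perm n v ≡ perm n u → length u ≤ length v)

data _∼c_ : List ℕ → List ℕ → Set where
  c-refl  : ∀ {u} → u ∼c u
  c-swap  : ∀ xs a b ys → (2 ≤ a ∸ b ⊎ 2 ≤ b ∸ a) →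
            (xs ++ a ∷ b ∷ ys) ∼c (xs ++ b ∷ a ∷ ys)
  c-trans : ∀ {u v w} → u ∼c v → v ∼c w → u ∼c w

FCWord : ℕ → List ℕ → Set
FCWord n u = Reduced n u × (∀ v → Reduced n v → perm n v ≡ perm n u → v ∼c u)

module Submission where

-- A canonical word [i₁,j₁]⋯[i_p,j_p] is reduced: read from the right, each letter it adds is an
-- ascent of what follows, so its length equals the number of inversions of its permutation, which
-- bounds the length of every word from below. It is fully commutative: the first letter a of any
-- reduced word for the same permutation is a left descent, the left descents of a canonical word are
-- exactly the a ∈ 𝓘 with a+1 ∉ 𝓘, and such a commutes to the front leaving a canonical word again.
--
-- A diagram with a tail is peeled at its largest tail i = i₁, whose dot is joined to i+1. Either the
-- dot i+2 is joined to a dot left of this cap, or every string right of the cap is vertical and (i+1)′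
-- is joined to the left; let Q be i+2, resp. (i+1)′. Joining i to the partner of Q and i+1 to Q gives
-- a non-crossing D′ with D = E_i ∗ D′, whose 𝓘 and 𝓙 are those of D with the first block [i, j₁]
-- shortened to [i+1, j₁] in the first case and removed in the second (where j₁ = i).

open import Defs

open import Data.Bool using (Bool; true; false; T)
open import Data.Empty using (⊥; ⊥-elim)
open import Data.Fin using (Fin; toℕ; fromℕ<) renaming (zero to fzero; suc to fsuc)
open import Data.Fin.Properties using (toℕ<n; toℕ-injective; toℕ-fromℕ<; fromℕ<-toℕ) renaming (_≟_ to _≟ᶠ_)
open import Data.List using (List; []; _∷_; _++_; map; foldl; upTo; applyUpTo; length; filter; filterᵇ; reverse; downFrom; allFin; tabulate)
open import Data.List.Membership.Propositional using (_∈_)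
open import Data.List.Properties using (map-∘; map-id; map-cong; map-applyUpTo; map-tabulate; ++-assoc; length-++; length-map; reverse-map; reverse-upTo; filter-accept; filter-reject)
open import Data.List.Relation.Binary.Permutation.Propositional.Properties using (↭-reverse; ↭-length; filter-↭)
open import Data.List.Relation.Binary.Pointwise using (Pointwise; []; _∷_; Pointwise-length)
open import Data.List.Relation.Unary.All using (All; []; _∷_)
import Data.List.Relation.Unary.All as All
open import Data.List.Relation.Unary.All.Properties using (++⁺; map⁺; filter⁺; applyDownFrom⁺₁)
open import Data.List.Relation.Unary.Any using (here; there)
open import Data.Maybe using (just; nothing)
import Data.Maybe as Maybe
open import Data.Nat using (ℕ; zero; suc; pred; _+_; _*_; _∸_; _≤_; _<_; z≤n; s≤s; _≟_; _<?_; _<ᵇ_)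
open import Data.Nat.ListAction using (sum)
open import Data.Nat.Properties
open import Algebra.Properties.CommutativeSemigroup +-commutativeSemigroup using (interchange)
open import Data.List.Membership.DecPropositional _≟_ using (_∈?_)
open import Data.Product using (Σ; _×_; _,_; proj₁; proj₂)
open import Data.Sum using (_⊎_; inj₁; inj₂; [_,_]′)
open import Data.Unit using (tt)
open import Function using (id; _∘_)
open import Relation.Binary.Definitions using (DecidableEquality; Tri; tri<; tri≈; tri>)
open import Relation.Binary.PropositionalEquality
open import Relation.Nullary using (¬_; Dec; yes; no; T?)
open import Relation.Nullary.Decidable using (map′)
open import Relation.Unary using (Decidable)

-- Words and the permutations they represent

swap : ℕ → ℕ → ℕ
swap zero    zero          = 1
swap zero    (suc zero)    = 0
swap zero    (suc (suc x)) = suc (suc x)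
swap (suc a) zero          = 0
swap (suc a) (suc x)       = suc (swap a x)

data SwapView (a : ℕ) : ℕ → ℕ → Set where
  at-a   : SwapView a a (suc a)
  at-suc : SwapView a (suc a) a
  away   : ∀ {x} → x ≢ a → x ≢ suc a → SwapView a x x

swapView : ∀ a x → SwapView a x (swap a x)
swapView zero    zero          = at-a
swapView zero    (suc zero)    = at-suc
swapView zero    (suc (suc x)) = away (λ ()) (λ ())
swapView (suc a) zero          = away (λ ()) (λ ())
swapView (suc a) (suc x) with swap a x | swapView a x
... | _ | at-a       = at-a
... | _ | at-suc     = at-suc
... | _ | away ≢a ≢1+a = away (≢a ∘ suc-injective) (≢1+a ∘ suc-injective)

swap-involutive : ∀ a x → swap a (swap a x) ≡ x
swap-involutive zero    zero          = refl
swap-involutive zero    (suc zero)    = refl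
swap-involutive zero    (suc (suc x)) = refl
swap-involutive (suc a) zero          = refl
swap-involutive (suc a) (suc x)       = cong suc (swap-involutive a x)

swap-comm : ∀ a b x → suc (suc b) ≤ a → swap a (swap b x) ≡ swap b (swap a x)
swap-comm (suc zero)    zero    x             (s≤s ())
swap-comm (suc (suc a)) zero    zero          _         = refl
swap-comm (suc (suc a)) zero    (suc zero)    _         = refl
swap-comm (suc (suc a)) zero    (suc (suc x)) _         = refl
swap-comm (suc a)       (suc b) zero          _         = refl
swap-comm (suc a)       (suc b) (suc x)       (s≤s b+2≤a) = cong suc (swap-comm a b x b+2≤a)

swap-at : ∀ a → swap a a ≡ suc a
swap-at a with swap a a | swapView a a
... | _ | at-a       = refl
... | _ | away ≢a _  = ⊥-elim (≢a refl)

swap-at-suc : ∀ a → swap a (suc a) ≡ a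
swap-at-suc a with swap a (suc a) | swapView a (suc a)
... | _ | at-suc       = refl
... | _ | away _ ≢1+a  = ⊥-elim (≢1+a refl)

swap-away : ∀ a x → x ≢ a → x ≢ suc a → swap a x ≡ x
swap-away a x ≢a ≢1+a with swap a x | swapView a x
... | _ | at-a     = ⊥-elim (≢a refl)
... | _ | at-suc   = ⊥-elim (≢1+a refl)
... | _ | away _ _ = refl

swap-≤ : ∀ {b j} x → b < j → x ≤ j → swap b x ≤ j
swap-≤ {b} x b<j x≤j with swap b x | swapView b x
... | _ | at-a     = b<j
... | _ | at-suc   = ≤-trans (n≤1+n b) x≤j
... | _ | away _ _ = x≤j

act : List ℕ → ℕ → ℕ
act []      x = x
act (a ∷ u) x = swap a (act u x)

act⁻¹ : List ℕ → ℕ → ℕ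
act⁻¹ []      x = x
act⁻¹ (a ∷ u) x = act⁻¹ u (swap a x)

act⁻¹-act : ∀ u x → act⁻¹ u (act u x) ≡ x
act⁻¹-act []      x = refl
act⁻¹-act (a ∷ u) x = trans (cong (act⁻¹ u) (swap-involutive a (act u x))) (act⁻¹-act u x)

act-act⁻¹ : ∀ u x → act u (act⁻¹ u x) ≡ x
act-act⁻¹ []      x = refl
act-act⁻¹ (a ∷ u) x = trans (cong (swap a) (act-act⁻¹ u (swap a x))) (swap-involutive a x)

act-++ : ∀ u v x → act (u ++ v) x ≡ act u (act v x)
act-++ []      v x = refl
act-++ (a ∷ u) v x = cong (swap a) (act-++ u v x)

act⁻¹-++ : ∀ u v x → act⁻¹ (u ++ v) x ≡ act⁻¹ v (act⁻¹ u x)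
act⁻¹-++ []      v x = refl
act⁻¹-++ (a ∷ u) v x = act⁻¹-++ u v (swap a x)

segment : ℕ → ℕ → List ℕ
segment s zero    = []
segment s (suc k) = s ∷ segment (suc s) k

applyUpTo-segment : ∀ (f : ℕ → ℕ) s k → (∀ x → f x ≡ s + x) → applyUpTo f k ≡ segment s k
applyUpTo-segment f s zero    f≗s+ = refl
applyUpTo-segment f s (suc k) f≗s+ =
  cong₂ _∷_ (trans (f≗s+ 0) (+-identityʳ s))
            (applyUpTo-segment (f ∘ suc) (suc s) k (λ x → trans (f≗s+ (suc x)) (+-suc s x)))

map-+-upTo : ∀ s k → map (s +_) (upTo k) ≡ segment s k
map-+-upTo s k = trans (map-applyUpTo id (s +_) k) (applyUpTo-segment (s +_) s k (λ x → refl))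

oneLine : ℕ → List ℕ → List ℕ
oneLine n u = map (act u) (segment 1 (suc n))

swapAt-map : ∀ k (g : ℕ → ℕ) l → swapAt k (map g l) ≡ map g (swapAt k l)
swapAt-map zero    g []          = refl
swapAt-map zero    g (x ∷ [])    = refl
swapAt-map zero    g (x ∷ y ∷ l) = refl
swapAt-map (suc k) g []          = refl
swapAt-map (suc k) g (x ∷ l)     = cong (g x ∷_) (swapAt-map k g l)

map-swap-segment-above : ∀ a t k → suc a < t → map (swap a) (segment t k) ≡ segment t k
map-swap-segment-above a t zero    a+1<t = refl
map-swap-segment-above a t (suc k) a+1<t =
  cong₂ _∷_ (swap-away a t (>⇒≢ (<-trans (n<1+n a) a+1<t)) (>⇒≢ a+1<t))
            (map-swap-segment-above a (suc t) k (m<n⇒m<1+n a+1<t))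

swapAt-segment : ∀ j s k → j + 2 ≤ k → swapAt j (segment s k) ≡ map (swap (s + j)) (segment s k)
swapAt-segment zero s (suc zero) (s≤s ())
swapAt-segment zero s (suc (suc k)) _ rewrite +-identityʳ s =
  cong₂ _∷_ (sym (swap-at s)) (cong₂ _∷_ (sym (swap-at-suc s)) (sym (map-swap-segment-above s (suc (suc s)) k ≤-refl)))
swapAt-segment (suc j) s (suc k) (s≤s j+2≤k) rewrite +-suc s j =
  cong₂ _∷_ (sym (swap-away (suc (s + j)) s (<⇒≢ (s≤s (m≤m+n s j))) (<⇒≢ (m<n⇒m<1+n (s≤s (m≤m+n s j))))))
            (swapAt-segment j (suc s) k j+2≤k)

foldl-swapAt : ∀ n (g : ℕ → ℕ) u → ValidWord n u →
  foldl (λ l a → swapAt (pred a) l) (map g (segment 1 (suc n))) u ≡ map (g ∘ act u) (segment 1 (suc n))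
foldl-swapAt n g [] [] = refl
foldl-swapAt n g (suc a ∷ u) ((s≤s z≤n , a<n) ∷ valid) = begin
  foldl step (swapAt a (map g (segment 1 (suc n)))) u
    ≡⟨ cong (λ l → foldl step l u) (trans (swapAt-map a g _) (cong (map g) (swapAt-segment a 1 (suc n) a+2≤n+1))) ⟩
  foldl step (map g (map (swap (suc a)) (segment 1 (suc n)))) u
    ≡⟨ cong (λ l → foldl step l u) (sym (map-∘ (segment 1 (suc n)))) ⟩
  foldl step (map (g ∘ swap (suc a)) (segment 1 (suc n))) u
    ≡⟨ foldl-swapAt n (g ∘ swap (suc a)) u valid ⟩
  map (g ∘ act (suc a ∷ u)) (segment 1 (suc n)) ∎
  where
  open ≡-Reasoning
  step = λ l a → swapAt (pred a) l
  a+2≤n+1 : a + 2 ≤ suc n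
  a+2≤n+1 = subst (_≤ suc n) (+-comm 2 a) (s≤s a<n)

perm≡oneLine : ∀ n u → ValidWord n u → perm n u ≡ oneLine n u
perm≡oneLine n u valid = begin
  perm n u                                                    ≡⟨ cong (λ l → foldl step l u) (trans (map-+-upTo 1 (suc n)) (sym (map-id _))) ⟩
  foldl step (map id (segment 1 (suc n))) u                  ≡⟨ foldl-swapAt n id u valid ⟩
  oneLine n u ∎
  where
  open ≡-Reasoning
  step = λ l a → swapAt (pred a) l

∼c-sym : ∀ {u v} → u ∼c v → v ∼c u
∼c-sym c-refl                         = c-refl
∼c-sym (c-swap xs a b ys (inj₁ far)) = c-swap xs b a ys (inj₂ far)
∼c-sym (c-swap xs a b ys (inj₂ far)) = c-swap xs b a ys (inj₁ far)
∼c-sym (c-trans u∼v v∼w)              = c-trans (∼c-sym v∼w) (∼c-sym u∼v)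

∼c-prefix : ∀ p {u v} → u ∼c v → (p ++ u) ∼c (p ++ v)
∼c-prefix p c-refl                = c-refl
∼c-prefix p (c-swap xs a b ys far) rewrite sym (++-assoc p xs (a ∷ b ∷ ys)) | sym (++-assoc p xs (b ∷ a ∷ ys)) =
  c-swap (p ++ xs) a b ys far
∼c-prefix p (c-trans u∼v v∼w)     = c-trans (∼c-prefix p u∼v) (∼c-prefix p v∼w)

far⇒≤ : ∀ a b → 2 ≤ a ∸ b → suc (suc b) ≤ a
far⇒≤ a       zero    2≤a   = 2≤a
far⇒≤ (suc a) (suc b) 2≤a∸b = s≤s (far⇒≤ a b 2≤a∸b)

∼c⇒act≗ : ∀ {u v} → u ∼c v → ∀ x → act u x ≡ act v x
∼c⇒act≗ c-refl x = refl
∼c⇒act≗ (c-swap xs a b ys far) x = begin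
  act (xs ++ a ∷ b ∷ ys) x        ≡⟨ act-++ xs (a ∷ b ∷ ys) x ⟩
  act xs (swap a (swap b y))      ≡⟨ cong (act xs) (commute far) ⟩
  act xs (swap b (swap a y))      ≡⟨ sym (act-++ xs (b ∷ a ∷ ys) x) ⟩
  act (xs ++ b ∷ a ∷ ys) x        ∎
  where
  open ≡-Reasoning
  y = act ys x
  commute : 2 ≤ a ∸ b ⊎ 2 ≤ b ∸ a → swap a (swap b y) ≡ swap b (swap a y)
  commute (inj₁ 2≤a∸b) = swap-comm a b y (far⇒≤ a b 2≤a∸b)
  commute (inj₂ 2≤b∸a) = sym (swap-comm b a y (far⇒≤ b a 2≤b∸a))
∼c⇒act≗ (c-trans u∼v v∼w) x = trans (∼c⇒act≗ u∼v x) (∼c⇒act≗ v∼w x)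

∼c-length : ∀ {u v} → u ∼c v → length u ≡ length v
∼c-length c-refl                 = refl
∼c-length (c-swap xs a b ys _)   = trans (length-++ xs) (sym (length-++ xs))
∼c-length (c-trans u∼v v∼w)      = trans (∼c-length u∼v) (∼c-length v∼w)

∼c-to-front : ∀ a p q → All (λ b → suc (suc a) ≤ b) p → (p ++ a ∷ q) ∼c (a ∷ p ++ q)
∼c-to-front a []      q []              = c-refl
∼c-to-front a (b ∷ p) q (a+2≤b ∷ a+2≤p) =
  c-trans (∼c-prefix (b ∷ []) (∼c-to-front a p q a+2≤p))
          (c-swap [] b a (p ++ q) (inj₁ (subst (_≤ b ∸ a) (m+n∸n≡m 2 a) (∸-monoˡ-≤ a a+2≤b))))

-- Inversions

count : {P : ℕ → Set} → Decidable P → List ℕ → ℕ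
count P? xs = length (filter P? xs)

count-yes : ∀ {P : ℕ → Set} (P? : Decidable P) {z zs} → P z → count P? (z ∷ zs) ≡ suc (count P? zs)
count-yes P? p = cong length (filter-accept P? p)

count-no : ∀ {P : ℕ → Set} (P? : Decidable P) {z zs} → ¬ P z → count P? (z ∷ zs) ≡ count P? zs
count-no P? ¬p = cong length (filter-reject P? ¬p)

count-map : ∀ {P Q : ℕ → Set} (P? : Decidable P) (Q? : Decidable Q) (f : ℕ → ℕ) →
            (∀ y → (P (f y) → Q y) × (Q y → P (f y))) → ∀ l → count P? (map f l) ≡ count Q? l
count-map P? Q? f P∘f⇔Q [] = refl
count-map {P} {Q} P? Q? f P∘f⇔Q (y ∷ l) = by-cases (P? (f y)) (Q? y)
  where
  by-cases : Dec (P (f y)) → Dec (Q y) → count P? (map f (y ∷ l)) ≡ count Q? (y ∷ l)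
  by-cases (yes p) (yes q) = trans (count-yes P? p) (trans (cong suc (count-map P? Q? f P∘f⇔Q l)) (sym (count-yes Q? q)))
  by-cases (yes p) (no ¬q) = ⊥-elim (¬q (proj₁ (P∘f⇔Q y) p))
  by-cases (no ¬p) (yes q) = ⊥-elim (¬p (proj₂ (P∘f⇔Q y) q))
  by-cases (no ¬p) (no ¬q) = trans (count-no P? ¬p) (trans (count-map P? Q? f P∘f⇔Q l) (sym (count-no Q? ¬q)))

occurrences : ℕ → List ℕ → ℕ
occurrences x = count (_≟ x)

countBelow : ℕ → List ℕ → ℕ
countBelow x = count (_<? x)

pairsAt : ℕ → ℕ → ℕ → List ℕ → ℕ
pairsAt x y z zs with z ≟ x
... | yes _ = occurrences y zs
... | no _  = 0

pairsBefore : ℕ → ℕ → List ℕ → ℕ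
pairsBefore x y []       = 0
pairsBefore x y (z ∷ zs) = pairsAt x y z zs + pairsBefore x y zs

inversions : List ℕ → ℕ
inversions []       = 0
inversions (z ∷ zs) = countBelow z zs + inversions zs

pairsAt-yes : ∀ {x} y {z} zs → z ≡ x → pairsAt x y z zs ≡ occurrences y zs
pairsAt-yes {x} y {z} zs z≡x with z ≟ x
... | yes _   = refl
... | no z≢x  = ⊥-elim (z≢x z≡x)

pairsAt-no : ∀ {x} y {z} zs → z ≢ x → pairsAt x y z zs ≡ 0
pairsAt-no {x} y {z} zs z≢x with z ≟ x
... | yes z≡x = ⊥-elim (z≢x z≡x)
... | no _    = refl

pairsBefore-yes : ∀ {x} y {z} zs → z ≡ x → pairsBefore x y (z ∷ zs) ≡ occurrences y zs + pairsBefore x y zs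
pairsBefore-yes {x} y zs z≡x = cong (_+ pairsBefore x y zs) (pairsAt-yes {x} y zs z≡x)

pairsBefore-no : ∀ {x} y {z} zs → z ≢ x → pairsBefore x y (z ∷ zs) ≡ pairsBefore x y zs
pairsBefore-no {x} y zs z≢x = cong (_+ pairsBefore x y zs) (pairsAt-no {x} y zs z≢x)

module _ (f g : ℕ → ℕ) (g∘f : ∀ z → g (f z) ≡ z) (f∘g : ∀ z → f (g z) ≡ z) where

  private
    f≡⇔≡g : ∀ x y → (f y ≡ x → y ≡ g x) × (y ≡ g x → f y ≡ x)
    f≡⇔≡g x y = (λ fy≡x → trans (sym (g∘f y)) (cong g fy≡x)) , (λ y≡gx → trans (cong f y≡gx) (f∘g x))

  occurrences-map : ∀ x l → occurrences x (map f l) ≡ occurrences (g x) l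
  occurrences-map x = count-map (_≟ x) (_≟ g x) f (f≡⇔≡g x)

  pairsBefore-map : ∀ x y l → pairsBefore x y (map f l) ≡ pairsBefore (g x) (g y) l
  pairsBefore-map x y []       = refl
  pairsBefore-map x y (z ∷ zs) with z ≟ g x
  ... | yes z≡gx = begin
    pairsBefore x y (f z ∷ map f zs)             ≡⟨ pairsBefore-yes y (map f zs) (proj₂ (f≡⇔≡g x z) z≡gx) ⟩
    occurrences y (map f zs) + pairsBefore x y (map f zs)
                                                 ≡⟨ cong₂ _+_ (occurrences-map y zs) (pairsBefore-map x y zs) ⟩
    occurrences (g y) zs + pairsBefore (g x) (g y) zs ∎
    where open ≡-Reasoning
  ... | no z≢gx = trans (pairsBefore-no y (map f zs) (z≢gx ∘ proj₁ (f≡⇔≡g x z))) (pairsBefore-map x y zs)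

occurrences-segment-below : ∀ {x s} k → x < s → occurrences x (segment s k) ≡ 0
occurrences-segment-below zero    x<s = refl
occurrences-segment-below (suc k) x<s = trans (count-no (_≟ _) (>⇒≢ x<s)) (occurrences-segment-below k (m<n⇒m<1+n x<s))

occurrences-segment : ∀ {x} s k → s ≤ x → x < s + k → occurrences x (segment s k) ≡ 1
occurrences-segment {x} s zero    s≤x x<s+0 = ⊥-elim (<⇒≱ x<s+0 (subst (_≤ x) (sym (+-identityʳ s)) s≤x))
occurrences-segment {x} s (suc k) s≤x x<s+k+1 = by-cases (s ≟ x)
  where
  by-cases : Dec (s ≡ x) → occurrences x (segment s (suc k)) ≡ 1
  by-cases (yes s≡x) = trans (count-yes (_≟ x) s≡x) (cong suc (occurrences-segment-below k (s≤s (≤-reflexive (sym s≡x)))))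
  by-cases (no s≢x)  = trans (count-no (_≟ x) s≢x) (occurrences-segment (suc s) k (≤∧≢⇒< s≤x s≢x) (subst (x <_) (+-suc s k) x<s+k+1))

pairsBefore-segment : ∀ {p q} s k → p < q → pairsBefore q p (segment s k) ≡ 0
pairsBefore-segment s zero    p<q = refl
pairsBefore-segment {p} {q} s (suc k) p<q = by-cases (s ≟ q)
  where
  by-cases : Dec (s ≡ q) → pairsBefore q p (segment s (suc k)) ≡ 0
  by-cases (yes s≡q) = trans (pairsBefore-yes p (segment (suc s) k) s≡q)
                             (cong₂ _+_ (occurrences-segment-below k (≤-trans p<q (≤-trans (≤-reflexive (sym s≡q)) (n≤1+n s))))
                                        (pairsBefore-segment (suc s) k p<q))
  by-cases (no s≢q)  = trans (pairsBefore-no p (segment (suc s) k) s≢q) (pairsBefore-segment (suc s) k p<q)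

pairsBefore-sym : ∀ {x y} l → x ≢ y → pairsBefore x y l + pairsBefore y x l ≡ occurrences x l * occurrences y l
pairsBefore-sym []       x≢y = refl
pairsBefore-sym {x} {y} (z ∷ zs) x≢y = by-cases (z ≟ x) (z ≟ y)
  where
  open ≡-Reasoning
  Pxy = pairsBefore x y zs
  Pyx = pairsBefore y x zs
  Ox = occurrences x zs
  Oy = occurrences y zs
  ih : Pxy + Pyx ≡ Ox * Oy
  ih = pairsBefore-sym zs x≢y
  by-cases : Dec (z ≡ x) → Dec (z ≡ y) →
             pairsBefore x y (z ∷ zs) + pairsBefore y x (z ∷ zs) ≡ occurrences x (z ∷ zs) * occurrences y (z ∷ zs)
  by-cases (yes z≡x) (yes z≡y) = ⊥-elim (x≢y (trans (sym z≡x) z≡y))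
  by-cases (yes z≡x) (no z≢y) = begin
    pairsBefore x y (z ∷ zs) + pairsBefore y x (z ∷ zs) ≡⟨ cong₂ _+_ (pairsBefore-yes y zs z≡x) (pairsBefore-no x zs z≢y) ⟩
    (Oy + Pxy) + Pyx                                    ≡⟨ +-assoc Oy Pxy Pyx ⟩
    Oy + (Pxy + Pyx)                                    ≡⟨ cong (Oy +_) ih ⟩
    Oy + Ox * Oy                                        ≡⟨ cong₂ _*_ (sym (count-yes (_≟ x) z≡x)) (sym (count-no (_≟ y) z≢y)) ⟩
    occurrences x (z ∷ zs) * occurrences y (z ∷ zs)     ∎
  by-cases (no z≢x) (yes z≡y) = begin
    pairsBefore x y (z ∷ zs) + pairsBefore y x (z ∷ zs) ≡⟨ cong₂ _+_ (pairsBefore-no y zs z≢x) (pairsBefore-yes x zs z≡y) ⟩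
    Pxy + (Ox + Pyx)                                    ≡⟨ +-comm Pxy (Ox + Pyx) ⟩
    (Ox + Pyx) + Pxy                                    ≡⟨ +-assoc Ox Pyx Pxy ⟩
    Ox + (Pyx + Pxy)                                    ≡⟨ cong (Ox +_) (trans (+-comm Pyx Pxy) ih) ⟩
    Ox + Ox * Oy                                        ≡⟨ sym (*-suc Ox Oy) ⟩
    Ox * suc Oy                                         ≡⟨ cong₂ _*_ (sym (count-no (_≟ x) z≢x)) (sym (count-yes (_≟ y) z≡y)) ⟩
    occurrences x (z ∷ zs) * occurrences y (z ∷ zs)     ∎
  by-cases (no z≢x) (no z≢y) = begin
    pairsBefore x y (z ∷ zs) + pairsBefore y x (z ∷ zs) ≡⟨ cong₂ _+_ (pairsBefore-no y zs z≢x) (pairsBefore-no x zs z≢y) ⟩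
    Pxy + Pyx                                           ≡⟨ ih ⟩
    Ox * Oy                                             ≡⟨ cong₂ _*_ (sym (count-no (_≟ x) z≢x)) (sym (count-no (_≟ y) z≢y)) ⟩
    occurrences x (z ∷ zs) * occurrences y (z ∷ zs)     ∎

countBelow-segment : ∀ {x s} k → x ≤ s → countBelow x (segment s k) ≡ 0
countBelow-segment zero    x≤s = refl
countBelow-segment (suc k) x≤s = trans (count-no (_<? _) (≤⇒≯ x≤s)) (countBelow-segment k (m≤n⇒m≤1+n x≤s))

inversions-segment : ∀ s k → inversions (segment s k) ≡ 0
inversions-segment s zero    = refl
inversions-segment s (suc k) = cong₂ _+_ (countBelow-segment k (n≤1+n s)) (inversions-segment (suc s) k)

countBelow-suc : ∀ x l → countBelow (suc x) l ≡ countBelow x l + occurrences x l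
countBelow-suc x []       = refl
countBelow-suc x (z ∷ zs) with <-cmp z x
... | tri< z<x z≢x _ = begin
  countBelow (suc x) (z ∷ zs)                 ≡⟨ count-yes (_<? suc x) (m<n⇒m<1+n z<x) ⟩
  suc (countBelow (suc x) zs)                 ≡⟨ cong suc (countBelow-suc x zs) ⟩
  suc (countBelow x zs + occurrences x zs)    ≡⟨ cong₂ _+_ (sym (count-yes (_<? x) z<x)) (sym (count-no (_≟ x) z≢x)) ⟩
  countBelow x (z ∷ zs) + occurrences x (z ∷ zs) ∎
  where open ≡-Reasoning
... | tri≈ z≮x z≡x _ = begin
  countBelow (suc x) (z ∷ zs)                 ≡⟨ count-yes (_<? suc x) (s≤s (≤-reflexive z≡x)) ⟩
  suc (countBelow (suc x) zs)                 ≡⟨ cong suc (countBelow-suc x zs) ⟩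
  suc (countBelow x zs + occurrences x zs)    ≡⟨ sym (+-suc _ _) ⟩
  countBelow x zs + suc (occurrences x zs)    ≡⟨ cong₂ _+_ (sym (count-no (_<? x) z≮x)) (sym (count-yes (_≟ x) z≡x)) ⟩
  countBelow x (z ∷ zs) + occurrences x (z ∷ zs) ∎
  where open ≡-Reasoning
... | tri> z≮x z≢x x<z = begin
  countBelow (suc x) (z ∷ zs)                 ≡⟨ count-no (_<? suc x) (<⇒≱ (s≤s x<z)) ⟩
  countBelow (suc x) zs                       ≡⟨ countBelow-suc x zs ⟩
  countBelow x zs + occurrences x zs          ≡⟨ cong₂ _+_ (sym (count-no (_<? x) z≮x)) (sym (count-no (_≟ x) z≢x)) ⟩
  countBelow x (z ∷ zs) + occurrences x (z ∷ zs) ∎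
  where open ≡-Reasoning

swap-<-iff : ∀ {a x} y → x ≢ suc a → (swap a y < x → y < x) × (y < x → swap a y < x)
swap-<-iff {a} {x} y x≢a+1 with swap a y | swapView a y
... | _ | at-a     = <⇒<pred , λ a<x → ≤∧≢⇒< a<x (x≢a+1 ∘ sym)
  where
  <⇒<pred : suc a < x → a < x
  <⇒<pred = <-trans (n<1+n a)
... | _ | at-suc   = (λ a<x → ≤∧≢⇒< a<x (x≢a+1 ∘ sym)) , <-trans (n<1+n a)
... | _ | away _ _ = (λ y<x → y<x) , (λ y<x → y<x)

countBelow-swap : ∀ {a x} l → x ≢ suc a → countBelow x (map (swap a) l) ≡ countBelow x l
countBelow-swap {a} {x} l x≢a+1 = count-map (_<? x) (_<? x) (swap a) (λ y → swap-<-iff y x≢a+1) l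

countBelow-suc-swap : ∀ a l → countBelow (suc a) (map (swap a) l) ≡ countBelow a l + occurrences (suc a) l
countBelow-suc-swap a l = begin
  countBelow (suc a) (map (swap a) l)                          ≡⟨ countBelow-suc a (map (swap a) l) ⟩
  countBelow a (map (swap a) l) + occurrences a (map (swap a) l)
     ≡⟨ cong₂ _+_ (countBelow-swap l (<⇒≢ (n<1+n a))) (occurrences-map (swap a) (swap a) (swap-involutive a) (swap-involutive a) a l) ⟩
  countBelow a l + occurrences (swap a a) l                    ≡⟨ cong (λ b → countBelow a l + occurrences b l) (swap-at a) ⟩
  countBelow a l + occurrences (suc a) l                       ∎
  where open ≡-Reasoning

inversions-swap-head : ∀ a z zs → countBelow (swap a z) (map (swap a) zs) + pairsAt (suc a) a z zs ≡ countBelow z zs + pairsAt a (suc a) z zs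
inversions-swap-head a z zs with swap a z | swapView a z
... | _ | at-a = begin
  countBelow (suc a) (map (swap a) zs) + pairsAt (suc a) a a zs   ≡⟨ cong₂ _+_ (countBelow-suc-swap a zs) (pairsAt-no {suc a} a zs (<⇒≢ (n<1+n a))) ⟩
  (countBelow a zs + occurrences (suc a) zs) + 0                   ≡⟨ +-identityʳ _ ⟩
  countBelow a zs + occurrences (suc a) zs                         ≡⟨ cong (countBelow a zs +_) (sym (pairsAt-yes {a} (suc a) zs refl)) ⟩
  countBelow a zs + pairsAt a (suc a) a zs                         ∎
  where open ≡-Reasoning
... | _ | at-suc = begin
  countBelow a (map (swap a) zs) + pairsAt (suc a) a (suc a) zs   ≡⟨ cong₂ _+_ (countBelow-swap zs (<⇒≢ (n<1+n a))) (pairsAt-yes {suc a} a zs refl) ⟩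
  countBelow a zs + occurrences a zs                               ≡⟨ sym (countBelow-suc a zs) ⟩
  countBelow (suc a) zs                                            ≡⟨ sym (+-identityʳ _) ⟩
  countBelow (suc a) zs + 0                                        ≡⟨ cong (countBelow (suc a) zs +_) (sym (pairsAt-no {a} (suc a) zs (>⇒≢ (n<1+n a)))) ⟩
  countBelow (suc a) zs + pairsAt a (suc a) (suc a) zs             ∎
  where open ≡-Reasoning
... | _ | away z≢a z≢a+1 =
  cong₂ _+_ (countBelow-swap zs z≢a+1) (trans (pairsAt-no {suc a} a zs z≢a+1) (sym (pairsAt-no {a} (suc a) zs z≢a)))

inversions-swap : ∀ a l → inversions (map (swap a) l) + pairsBefore (suc a) a l ≡ inversions l + pairsBefore a (suc a) l
inversions-swap a []       = refl
inversions-swap a (z ∷ zs) = begin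
  (C′ + I′) + (H′ + Y)      ≡⟨ interchange C′ I′ H′ Y ⟩
  (C′ + H′) + (I′ + Y)      ≡⟨ cong₂ _+_ (inversions-swap-head a z zs) (inversions-swap a zs) ⟩
  (C + H) + (I + X)         ≡⟨ interchange C H I X ⟩
  (C + I) + (H + X)         ∎
  where
  open ≡-Reasoning
  C′ = countBelow (swap a z) (map (swap a) zs)
  C = countBelow z zs
  H′ = pairsAt (suc a) a z zs
  H = pairsAt a (suc a) z zs
  I′ = inversions (map (swap a) zs)
  I = inversions zs
  X = pairsBefore a (suc a) zs
  Y = pairsBefore (suc a) a zs

Point : ℕ → ℕ → Set
Point n x = 1 ≤ x × x ≤ suc n

swap-point : ∀ {n b} x → 1 ≤ b × b ≤ n → Point n x → Point n (swap b x)
swap-point {n} {b} x (1≤b , b≤n) x-point with swap b x | swapView b x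
... | _ | at-a     = s≤s z≤n , s≤s b≤n
... | _ | at-suc   = 1≤b , m≤n⇒m≤1+n b≤n
... | _ | away _ _ = x-point

act⁻¹-point : ∀ {n} w x → ValidWord n w → Point n x → Point n (act⁻¹ w x)
act⁻¹-point []      x []                   x-point = x-point
act⁻¹-point (b ∷ w) x (b-valid ∷ w-valid) x-point = act⁻¹-point w (swap b x) w-valid (swap-point x b-valid x-point)

oneLine-∷ : ∀ n a w → oneLine n (a ∷ w) ≡ map (swap a) (oneLine n w)
oneLine-∷ n a w = map-∘ (segment 1 (suc n))

occurrences-oneLine : ∀ n w x → ValidWord n w → Point n x → occurrences x (oneLine n w) ≡ 1
occurrences-oneLine n w x w-valid x-point = trans
  (occurrences-map (act w) (act⁻¹ w) (act⁻¹-act w) (act-act⁻¹ w) x (segment 1 (suc n)))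
  (occurrences-segment 1 (suc n) 1≤y (s≤s y≤n+1))
  where
  1≤y = proj₁ (act⁻¹-point w x w-valid x-point)
  y≤n+1 = proj₂ (act⁻¹-point w x w-valid x-point)

pairsBefore-oneLine : ∀ n w a → ValidWord n w → 1 ≤ a × a ≤ n →
                      pairsBefore a (suc a) (oneLine n w) + pairsBefore (suc a) a (oneLine n w) ≡ 1
pairsBefore-oneLine n w a w-valid (1≤a , a≤n) = trans (pairsBefore-sym (oneLine n w) (<⇒≢ (n<1+n a)))
  (cong₂ _*_ (occurrences-oneLine n w a w-valid (1≤a , m≤n⇒m≤1+n a≤n))
             (occurrences-oneLine n w (suc a) w-valid (m≤n⇒m≤1+n 1≤a , s≤s a≤n)))

ascent⇒pairsBefore≡0 : ∀ n w a → act⁻¹ w a < act⁻¹ w (suc a) → pairsBefore (suc a) a (oneLine n w) ≡ 0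
ascent⇒pairsBefore≡0 n w a ascent = trans
  (pairsBefore-map (act w) (act⁻¹ w) (act⁻¹-act w) (act-act⁻¹ w) (suc a) a (segment 1 (suc n)))
  (pairsBefore-segment 1 (suc n) ascent)

inversions-oneLine≤length : ∀ n v → ValidWord n v → inversions (oneLine n v) ≤ length v
inversions-oneLine≤length n []      []                  = ≤-reflexive (trans (cong inversions (map-id (segment 1 (suc n)))) (inversions-segment 1 (suc n)))
inversions-oneLine≤length n (a ∷ v) (a-valid ∷ v-valid) = begin
  inversions (oneLine n (a ∷ v))      ≡⟨ cong inversions (oneLine-∷ n a v) ⟩
  inversions (map (swap a) l)         ≤⟨ m≤m+n _ Y ⟩
  inversions (map (swap a) l) + Y     ≡⟨ inversions-swap a l ⟩
  inversions l + X                    ≤⟨ +-mono-≤ (inversions-oneLine≤length n v v-valid) (m≤m+n X Y) ⟩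
  length v + (X + Y)                  ≡⟨ cong (length v +_) (pairsBefore-oneLine n v a v-valid a-valid) ⟩
  length v + 1                        ≡⟨ +-comm (length v) 1 ⟩
  length (a ∷ v)                      ∎
  where
  open ≤-Reasoning
  l = oneLine n v
  X = pairsBefore a (suc a) l
  Y = pairsBefore (suc a) a l

inversions-oneLine-ascent : ∀ n a w → ValidWord n w → 1 ≤ a × a ≤ n → act⁻¹ w a < act⁻¹ w (suc a) →
                            inversions (oneLine n (a ∷ w)) ≡ suc (inversions (oneLine n w))
inversions-oneLine-ascent n a w w-valid a-valid ascent = begin
  inversions (oneLine n (a ∷ w))           ≡⟨ sym (+-identityʳ _) ⟩
  inversions (oneLine n (a ∷ w)) + 0       ≡⟨ cong₂ _+_ (cong inversions (oneLine-∷ n a w)) (sym Y≡0) ⟩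
  inversions (map (swap a) l) + Y          ≡⟨ inversions-swap a l ⟩
  inversions l + X                         ≡⟨ cong (inversions l +_) X≡1 ⟩
  inversions l + 1                         ≡⟨ +-comm (inversions l) 1 ⟩
  suc (inversions l)                       ∎
  where
  open ≡-Reasoning
  l = oneLine n w
  X = pairsBefore a (suc a) l
  Y = pairsBefore (suc a) a l
  Y≡0 : Y ≡ 0
  Y≡0 = ascent⇒pairsBefore≡0 n w a ascent
  X≡1 : X ≡ 1
  X≡1 = trans (sym (+-identityʳ X)) (trans (cong (X +_) (sym Y≡0)) (pairsBefore-oneLine n w a w-valid a-valid))

-- Canonical words

data Canonical (n : ℕ) : List ℕ → List ℕ → Set where
  []   : Canonical n [] []
  cons : ∀ {i j is js} → 1 ≤ i → i ≤ j → j ≤ n → All (_< i) is → All (_< j) js →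
         Canonical n is js → Canonical n (i ∷ is) (j ∷ js)

interval≡segment : ∀ i j → interval i j ≡ segment i (suc (j ∸ i))
interval≡segment i j = map-+-upTo i (suc (j ∸ i))

interval-∷ : ∀ {i j} → i < j → interval i j ≡ i ∷ interval (suc i) j
interval-∷ {i} {suc j} (s≤s i≤j) = begin
  interval i (suc j)                    ≡⟨ interval≡segment i (suc j) ⟩
  i ∷ segment (suc i) (suc j ∸ i)       ≡⟨ cong (λ k → i ∷ segment (suc i) k) (+-∸-assoc 1 i≤j) ⟩
  i ∷ segment (suc i) (suc (j ∸ i))     ≡⟨ cong (i ∷_) (sym (interval≡segment (suc i) (suc j))) ⟩
  i ∷ interval (suc i) (suc j)          ∎
  where open ≡-Reasoning

interval-single : ∀ i → interval i i ≡ i ∷ []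
interval-single i = trans (interval≡segment i i) (cong (λ k → segment i (suc k)) (n∸n≡0 i))

segment-bounds : ∀ s k → All (λ b → s ≤ b × b < s + k) (segment s k)
segment-bounds s zero    = []
segment-bounds s (suc k) = (≤-refl , m<m+n s (s≤s z≤n))
  ∷ All.map (λ { {b} (s<b , b<s+k) → <⇒≤ s<b , subst (b <_) (sym (+-suc s k)) b<s+k }) (segment-bounds (suc s) k)

interval-end : ∀ {i j} → i ≤ j → i + suc (j ∸ i) ≡ suc j
interval-end {i} {j} i≤j = trans (+-suc i (j ∸ i)) (cong suc (m+[n∸m]≡n i≤j))

interval-bounds : ∀ {i j} → i ≤ j → All (λ b → i ≤ b × b ≤ j) (interval i j)
interval-bounds {i} {j} i≤j rewrite interval≡segment i j =
  All.map (λ { {b} (i≤b , b<end) → i≤b , ≤-pred (subst (b <_) end≡1+j b<end) }) (segment-bounds i (suc (j ∸ i)))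
  where
  end≡1+j = interval-end i≤j

canonWord-below : ∀ {n is js} b → Canonical n is js → All (_< b) js → All (_< b) (canonWord is js)
canonWord-below b []                            []            = []
canonWord-below b (cons _ i≤j _ _ _ canonical) (j<b ∷ js<b) =
  ++⁺ (All.map (λ { (_ , c≤j) → ≤-<-trans c≤j j<b }) (interval-bounds i≤j)) (canonWord-below b canonical js<b)

canonWord-valid : ∀ {n is js} → Canonical n is js → ValidWord n (canonWord is js)
canonWord-valid []                                 = []
canonWord-valid (cons 1≤i i≤j j≤n _ _ canonical) =
  ++⁺ (All.map (λ { (i≤c , c≤j) → ≤-trans 1≤i i≤c , ≤-trans c≤j j≤n }) (interval-bounds i≤j)) (canonWord-valid canonical)

act⁻¹-segment-below : ∀ {x} i k → x < i → act⁻¹ (segment i k) x ≡ x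
act⁻¹-segment-below i zero    x<i = refl
act⁻¹-segment-below i (suc k) x<i =
  trans (cong (act⁻¹ (segment (suc i) k)) (swap-away i _ (<⇒≢ x<i) (<⇒≢ (m<n⇒m<1+n x<i))))
        (act⁻¹-segment-below (suc i) k (m<n⇒m<1+n x<i))

act⁻¹-segment-above : ∀ {x} i k → i + k < x → act⁻¹ (segment i k) x ≡ x
act⁻¹-segment-above i zero    i+0<x = refl
act⁻¹-segment-above {x} i (suc k) i+k+1<x =
  trans (cong (act⁻¹ (segment (suc i) k)) (swap-away i x (>⇒≢ i<x) (>⇒≢ i+1<x)))
        (act⁻¹-segment-above (suc i) k (subst (_< x) (+-suc i k) i+k+1<x))
  where
  i+1<x : suc i < x
  i+1<x = ≤-<-trans (s≤s (m≤m+n i k)) (subst (_< x) (+-suc i k) i+k+1<x)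
  i<x : i < x
  i<x = <-trans (n<1+n i) i+1<x

act⁻¹-segment-start : ∀ i k → act⁻¹ (segment i k) i ≡ i + k
act⁻¹-segment-start i zero    = sym (+-identityʳ i)
act⁻¹-segment-start i (suc k) =
  trans (cong (act⁻¹ (segment (suc i) k)) (swap-at i)) (trans (act⁻¹-segment-start (suc i) k) (sym (+-suc i k)))

act⁻¹-segment-shift : ∀ {x} i k → i < x → x ≤ i + k → act⁻¹ (segment i k) x ≡ pred x
act⁻¹-segment-shift {x} i zero    i<x x≤i+0 = ⊥-elim (<⇒≱ i<x (subst (x ≤_) (+-identityʳ i) x≤i+0))
act⁻¹-segment-shift {x} i (suc k) i<x x≤i+k+1 with <-cmp x (suc i)
... | tri< x<i+1 _ _    = ⊥-elim (<⇒≱ i<x (≤-pred x<i+1))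
... | tri≈ _ refl _     = trans (cong (act⁻¹ (segment (suc i) k)) (swap-at-suc i)) (act⁻¹-segment-below (suc i) k (n<1+n i))
... | tri> _ _ i+1<x    =
  trans (cong (act⁻¹ (segment (suc i) k)) (swap-away i x (>⇒≢ i<x) (>⇒≢ i+1<x)))
        (act⁻¹-segment-shift (suc i) k i+1<x (subst (x ≤_) (+-suc i k) x≤i+k+1))

act⁻¹-below-≤ : ∀ {j} w x → All (_< j) w → x ≤ j → act⁻¹ w x ≤ j
act⁻¹-below-≤ []      x []            x≤j = x≤j
act⁻¹-below-≤ (b ∷ w) x (b<j ∷ w<j) x≤j = act⁻¹-below-≤ w (swap b x) w<j (swap-≤ x b<j x≤j)

act⁻¹-below-fixes : ∀ {j} w x → All (_< j) w → j < x → act⁻¹ w x ≡ x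
act⁻¹-below-fixes []      x []            j<x = refl
act⁻¹-below-fixes (b ∷ w) x (b<j ∷ w<j) j<x =
  trans (cong (act⁻¹ w) (swap-away b x (>⇒≢ (<-trans b<j j<x)) (>⇒≢ (≤-<-trans b<j j<x)))) (act⁻¹-below-fixes w x w<j j<x)

module _ {i j : ℕ} (i≤j : i ≤ j) where

  private
    act⁻¹-interval : ∀ x → act⁻¹ (interval i j) x ≡ act⁻¹ (segment i (suc (j ∸ i))) x
    act⁻¹-interval x = cong (λ w → act⁻¹ w x) (interval≡segment i j)

  act⁻¹-interval-below : ∀ {x} → x < i → act⁻¹ (interval i j) x ≡ x
  act⁻¹-interval-below x<i = trans (act⁻¹-interval _) (act⁻¹-segment-below i (suc (j ∸ i)) x<i)

  act⁻¹-interval-start : act⁻¹ (interval i j) i ≡ suc j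
  act⁻¹-interval-start = trans (act⁻¹-interval i) (trans (act⁻¹-segment-start i _) (interval-end i≤j))

  act⁻¹-interval-shift : ∀ {x} → i < x → x ≤ suc j → act⁻¹ (interval i j) x ≡ pred x
  act⁻¹-interval-shift {x} i<x x≤j+1 =
    trans (act⁻¹-interval x) (act⁻¹-segment-shift i _ i<x (subst (x ≤_) (sym (interval-end i≤j)) x≤j+1))

  act⁻¹-interval-above : ∀ {x} → suc j < x → act⁻¹ (interval i j) x ≡ x
  act⁻¹-interval-above {x} j+1<x =
    trans (act⁻¹-interval x) (act⁻¹-segment-above i _ (subst (_< x) (sym (interval-end i≤j)) j+1<x))

All<⇒∉ : ∀ {i is} → All (_< i) is → ¬ i ∈ is
All<⇒∉ is<i i∈is = <-irrefl refl (All.lookup is<i i∈is)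

All<⇒suc∉ : ∀ {i is} → All (_< i) is → ¬ suc i ∈ i ∷ is
All<⇒suc∉ _    (here i+1≡i)   = 1+n≢n i+1≡i
All<⇒suc∉ is<i (there i+1∈is) = All<⇒∉ (All.map m<n⇒m<1+n is<i) i+1∈is

ascent-after-interval : ∀ {i j a} w → i ≤ j → All (_< j) w → a ≢ i →
                        (suc a < i → act⁻¹ w a < act⁻¹ w (suc a)) → (∀ {x} → i ≤ x → act⁻¹ w x < act⁻¹ w (suc x)) →
                        act⁻¹ (interval i j ++ w) a < act⁻¹ (interval i j ++ w) (suc a)
ascent-after-interval {i} {j} {a} w i≤j w<j a≢i ascent-below ascent-above =
  subst₂ _<_ (sym (act⁻¹-++ (interval i j) w a)) (sym (act⁻¹-++ (interval i j) w (suc a))) (by-position (<-cmp (suc a) i))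
  where
  Goal = act⁻¹ w (act⁻¹ (interval i j) a) < act⁻¹ w (act⁻¹ (interval i j) (suc a))

  shifted-ascent : ∀ {x} → i < x → act⁻¹ w (pred x) < act⁻¹ w x
  shifted-ascent {suc x} (s≤s i≤x) = ascent-above i≤x

  past-i : i < a → Tri (a < suc j) (a ≡ suc j) (suc j < a) → Goal
  past-i i<a (tri< a<j+1 _ _)
    rewrite act⁻¹-interval-shift i≤j i<a (<⇒≤ a<j+1) | act⁻¹-interval-shift i≤j (m<n⇒m<1+n i<a) a<j+1
    = shifted-ascent i<a
  past-i i<a (tri≈ _ refl _)
    rewrite act⁻¹-interval-shift i≤j i<a ≤-refl | act⁻¹-interval-above i≤j (n<1+n (suc j))
          | act⁻¹-below-fixes w (suc (suc j)) w<j (m<n⇒m<1+n (n<1+n j))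
    = s≤s (m≤n⇒m≤1+n (act⁻¹-below-≤ w j w<j ≤-refl))
  past-i i<a (tri> _ _ j+1<a)
    rewrite act⁻¹-interval-above i≤j j+1<a | act⁻¹-interval-above i≤j (m<n⇒m<1+n j+1<a)
          | act⁻¹-below-fixes w a w<j (<-trans (n<1+n j) j+1<a)
          | act⁻¹-below-fixes w (suc a) w<j (<-trans (n<1+n j) (m<n⇒m<1+n j+1<a))
    = n<1+n a

  by-position : Tri (suc a < i) (suc a ≡ i) (i < suc a) → Goal
  by-position (tri< a+1<i _ _)
    rewrite act⁻¹-interval-below i≤j (<-trans (n<1+n a) a+1<i) | act⁻¹-interval-below i≤j a+1<i
    = ascent-below a+1<i
  by-position (tri≈ _ refl _)
    rewrite act⁻¹-interval-below i≤j (n<1+n a) | act⁻¹-interval-start i≤j | act⁻¹-below-fixes w (suc j) w<j (n<1+n j)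
    = s≤s (act⁻¹-below-≤ w a w<j (≤-trans (n≤1+n a) i≤j))
  by-position (tri> _ _ i<a+1) = past-i (≤∧≢⇒< (≤-pred i<a+1) (a≢i ∘ sym)) (<-cmp a (suc j))

canonical-ascent : ∀ {n is js a} → Canonical n is js → (¬ a ∈ is ⊎ suc a ∈ is) →
                   act⁻¹ (canonWord is js) a < act⁻¹ (canonWord is js) (suc a)
canonical-ascent [] _ = n<1+n _
canonical-ascent {is = i ∷ is} {j ∷ js} {a} (cons _ i≤j _ is<i js<j canonical) a∉⊎a+1∈ =
  ascent-after-interval (canonWord is js) i≤j (canonWord-below j canonical js<j) a≢i
    (λ a+1<i → canonical-ascent canonical (drop-head a+1<i a∉⊎a+1∈))
    (λ i≤x → canonical-ascent canonical (inj₁ (All<⇒∉ (All.map (λ b<i → <-≤-trans b<i i≤x) is<i))))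
  where
  drop-head : suc a < i → ¬ a ∈ i ∷ is ⊎ suc a ∈ i ∷ is → ¬ a ∈ is ⊎ suc a ∈ is
  drop-head _      (inj₁ a∉)              = inj₁ (a∉ ∘ there)
  drop-head a+1<i (inj₂ (here a+1≡i))    = ⊥-elim (<-irrefl a+1≡i a+1<i)
  drop-head _      (inj₂ (there a+1∈is))  = inj₂ a+1∈is

  i-not-descent : ¬ (¬ i ∈ i ∷ is ⊎ suc i ∈ i ∷ is)
  i-not-descent (inj₁ i∉)     = i∉ (here refl)
  i-not-descent (inj₂ i+1∈)   = All<⇒suc∉ is<i i+1∈

  a≢i : a ≢ i
  a≢i a≡i = i-not-descent (subst (λ x → ¬ x ∈ i ∷ is ⊎ suc x ∈ i ∷ is) a≡i a∉⊎a+1∈)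

record Peel (n a : ℕ) (is js : List ℕ) : Set where
  field
    {is′ js′}  : List ℕ
    canonical  : Canonical n is′ js′
    commutes   : canonWord is js ∼c (a ∷ canonWord is′ js′)
    a∉is′      : ¬ a ∈ is′
    is′-below  : ∀ b → All (_< b) is → suc a < b → All (_< b) is′
    js′-below  : ∀ b → All (_< b) js → All (_< b) js′

≡⇒∼c : ∀ {u v} → u ≡ v → u ∼c v
≡⇒∼c refl = c-refl

peel : ∀ {n is js a} → Canonical n is js → a ∈ is → ¬ suc a ∈ is → Peel n a is js
peel {is = i ∷ is} {j ∷ js} (cons 1≤i i≤j j≤n is<i js<j canonical) (here refl) _ with m≤n⇒m<n∨m≡n i≤j
... | inj₁ i<j = record
  { canonical = cons (m≤n⇒m≤1+n 1≤i) i<j j≤n (All.map m<n⇒m<1+n is<i) js<j canonical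
  ; commutes  = ≡⇒∼c (cong (_++ canonWord is js) (interval-∷ i<j))
  ; a∉is′     = λ { (here i≡i+1) → 1+n≢n (sym i≡i+1) ; (there i∈is) → All<⇒∉ is<i i∈is }
  ; is′-below = λ { b (_ ∷ is<b) i+1<b → i+1<b ∷ is<b }
  ; js′-below = λ b js<b → js<b
  }
... | inj₂ refl = record
  { canonical = canonical
  ; commutes  = ≡⇒∼c (cong (_++ canonWord is js) (interval-single i))
  ; a∉is′     = All<⇒∉ is<i
  ; is′-below = λ { b (_ ∷ is<b) _ → is<b }
  ; js′-below = λ { b (_ ∷ js<b) → js<b }
  }
peel {n} {i ∷ is} {j ∷ js} {a} (cons 1≤i i≤j j≤n is<i js<j canonical) (there a∈is) a+1∉ = record
  { canonical = cons 1≤i i≤j j≤n (P.is′-below i is<i a+1<i) (P.js′-below j js<j) P.canonical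
  ; commutes  = c-trans (∼c-prefix (interval i j) P.commutes) (∼c-to-front a (interval i j) (canonWord P.is′ P.js′) a+2≤block)
  ; a∉is′     = λ { (here a≡i) → <-irrefl a≡i a<i ; (there a∈is′) → P.a∉is′ a∈is′ }
  ; is′-below = λ { b (i<b ∷ is<b) a+1<b → i<b ∷ P.is′-below b is<b a+1<b }
  ; js′-below = λ { b (j<b ∷ js<b) → j<b ∷ P.js′-below b js<b }
  }
  where
  module P = Peel (peel canonical a∈is (a+1∉ ∘ there))
  a<i : a < i
  a<i = All.lookup is<i a∈is
  a+1<i : suc a < i
  a+1<i = ≤∧≢⇒< a<i (a+1∉ ∘ here)
  a+2≤block : All (λ b → suc (suc a) ≤ b) (interval i j)
  a+2≤block = All.map (λ { (i≤b , _) → ≤-trans a+1<i i≤b }) (interval-bounds i≤j)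

peel-head : ∀ {n i j is js} → Canonical n (i ∷ is) (j ∷ js) → Peel n i (i ∷ is) (j ∷ js)
peel-head c@(cons _ _ _ is<i _ _) = peel c (here refl) (All<⇒suc∉ is<i)

grow-block : ∀ {n i is js} → Canonical n (suc i ∷ is) js → 1 ≤ i → All (_< i) is →
             Canonical n (i ∷ is) js × canonWord (i ∷ is) js ≡ i ∷ canonWord (suc i ∷ is) js
grow-block {is = is} {j ∷ js} (cons _ i<j j≤n _ js<j canonical) 1≤i is<i =
  cons 1≤i (<⇒≤ i<j) j≤n is<i js<j canonical , cong (_++ canonWord is js) (interval-∷ i<j)

new-block : ∀ {n i is js} → Canonical n is js → 1 ≤ i → i ≤ n → All (_< i) is → All (_< i) js →
            Canonical n (i ∷ is) (i ∷ js) × canonWord (i ∷ is) (i ∷ js) ≡ i ∷ canonWord is js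
new-block {is = is} {js} canonical 1≤i i≤n is<i js<i =
  cons 1≤i ≤-refl i≤n is<i js<i canonical , cong (_++ canonWord is js) (interval-single _)

Canonical⇒Pointwise≤ : ∀ {n is js} → Canonical n is js → Pointwise _≤_ is js
Canonical⇒Pointwise≤ []                                = []
Canonical⇒Pointwise≤ (cons _ i≤j _ _ _ canonical)     = i≤j ∷ Canonical⇒Pointwise≤ canonical

oneLine-∼c : ∀ n {u v} → u ∼c v → oneLine n u ≡ oneLine n v
oneLine-∼c n u∼v = map-cong (∼c⇒act≗ u∼v) (segment 1 (suc n))

oneLine-∷-cong : ∀ n a u v → oneLine n u ≡ oneLine n v → oneLine n (a ∷ u) ≡ oneLine n (a ∷ v)
oneLine-∷-cong n a u v u≡v = trans (oneLine-∷ n a u) (trans (cong (map (swap a)) u≡v) (sym (oneLine-∷ n a v)))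

oneLine-∷-cancel : ∀ n a u v → oneLine n (a ∷ u) ≡ oneLine n (a ∷ v) → oneLine n u ≡ oneLine n v
oneLine-∷-cancel n a u v a∷u≡a∷v = begin
  oneLine n u                                      ≡⟨ sym (map-swap-swap (oneLine n u)) ⟩
  map (swap a) (map (swap a) (oneLine n u))       ≡⟨ cong (map (swap a)) (trans (sym (oneLine-∷ n a u)) (trans a∷u≡a∷v (oneLine-∷ n a v))) ⟩
  map (swap a) (map (swap a) (oneLine n v))       ≡⟨ map-swap-swap (oneLine n v) ⟩
  oneLine n v                                      ∎
  where
  open ≡-Reasoning
  map-swap-swap : ∀ l → map (swap a) (map (swap a) l) ≡ l
  map-swap-swap l = trans (sym (map-∘ l)) (trans (map-cong (swap-involutive a) l) (map-id l))

perm≡⇒oneLine≡ : ∀ {n u v} → ValidWord n u → ValidWord n v → perm n u ≡ perm n v → oneLine n u ≡ oneLine n v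
perm≡⇒oneLine≡ {n} {u} {v} u-valid v-valid u≡v = trans (sym (perm≡oneLine n u u-valid)) (trans u≡v (perm≡oneLine n v v-valid))

inversions-canonWord : ∀ {n is js} → Canonical n is js → inversions (oneLine n (canonWord is js)) ≡ length (canonWord is js)
inversions-canonWord canonical = by-length _ canonical refl
  where
  by-length : ∀ {n is js} N → Canonical n is js → length (canonWord is js) ≡ N → inversions (oneLine n (canonWord is js)) ≡ N
  by-length {n} _ [] refl = trans (cong inversions (map-id (segment 1 (suc n)))) (inversions-segment 1 (suc n))
  by-length zero c@(cons _ _ _ _ _ _) len≡0 = ⊥-elim (1+n≢0 (trans (sym (∼c-length (Peel.commutes (peel-head c)))) len≡0))
  by-length {n} {i ∷ is} {j ∷ js} (suc N) c@(cons 1≤i i≤j j≤n _ _ _) len≡N+1 = begin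
    inversions (oneLine n (canonWord (i ∷ is) (j ∷ js)))   ≡⟨ cong inversions (oneLine-∼c n P.commutes) ⟩
    inversions (oneLine n (i ∷ w′))                         ≡⟨ inversions-oneLine-ascent n i w′ (canonWord-valid P.canonical) (1≤i , ≤-trans i≤j j≤n) ascent ⟩
    suc (inversions (oneLine n w′))                         ≡⟨ cong suc (by-length N P.canonical (suc-injective (trans (sym (∼c-length P.commutes)) len≡N+1))) ⟩
    suc N                                                   ∎
    where
    open ≡-Reasoning
    module P = Peel (peel-head c)
    w′ = canonWord P.is′ P.js′
    ascent = canonical-ascent P.canonical (inj₁ P.a∉is′)

canonWord-reduced : ∀ {n is js} → Canonical n is js → Reduced n (canonWord is js)
canonWord-reduced {n} {is} {js} canonical = w-valid , λ v v-valid v≡w → begin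
  length w                      ≡⟨ sym (inversions-canonWord canonical) ⟩
  inversions (oneLine n w)      ≡⟨ cong inversions (perm≡⇒oneLine≡ w-valid v-valid (sym v≡w)) ⟩
  inversions (oneLine n v)      ≤⟨ inversions-oneLine≤length n v v-valid ⟩
  length v                      ∎
  where
  open ≤-Reasoning
  w = canonWord is js
  w-valid = canonWord-valid canonical

pairsBefore-∷ : ∀ n a v → pairsBefore (suc a) a (oneLine n (a ∷ v)) ≡ pairsBefore a (suc a) (oneLine n v)
pairsBefore-∷ n a v = begin
  pairsBefore (suc a) a (oneLine n (a ∷ v))                   ≡⟨ cong (pairsBefore (suc a) a) (oneLine-∷ n a v) ⟩
  pairsBefore (suc a) a (map (swap a) (oneLine n v))          ≡⟨ pairsBefore-map (swap a) (swap a) (swap-involutive a) (swap-involutive a) (suc a) a (oneLine n v) ⟩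
  pairsBefore (swap a (suc a)) (swap a a) (oneLine n v)       ≡⟨ cong₂ (λ x y → pairsBefore x y (oneLine n v)) (swap-at-suc a) (swap-at a) ⟩
  pairsBefore a (suc a) (oneLine n v)                         ∎
  where open ≡-Reasoning

tight-word-starts-with-descent : ∀ n a v → ValidWord n (a ∷ v) → length (a ∷ v) ≤ inversions (oneLine n (a ∷ v)) →
                                 pairsBefore (suc a) a (oneLine n (a ∷ v)) ≢ 0
tight-word-starts-with-descent n a v (_ ∷ v-valid) tight descent≡0 = <-irrefl refl (begin-strict
  length (a ∷ v)                        ≤⟨ tight ⟩
  inversions (oneLine n (a ∷ v))        ≡⟨ cong inversions (oneLine-∷ n a v) ⟩
  inversions (map (swap a) l)           ≤⟨ m≤m+n _ (pairsBefore (suc a) a l) ⟩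
  inversions (map (swap a) l) + pairsBefore (suc a) a l
                                        ≡⟨ inversions-swap a l ⟩
  inversions l + pairsBefore a (suc a) l
                                        ≡⟨ cong (inversions l +_) (trans (sym (pairsBefore-∷ n a v)) descent≡0) ⟩
  inversions l + 0                      ≡⟨ +-identityʳ _ ⟩
  inversions l                          ≤⟨ inversions-oneLine≤length n v v-valid ⟩
  length v                              <⟨ n<1+n _ ⟩
  length (a ∷ v)                        ∎)
  where
  open ≤-Reasoning
  l = oneLine n v

canonical-descent : ∀ {n is js a} → Canonical n is js → pairsBefore (suc a) a (oneLine n (canonWord is js)) ≢ 0 →
                    a ∈ is × ¬ suc a ∈ is
canonical-descent {n} {is} {js} {a} canonical descent with a ∈? is | suc a ∈? is
... | no a∉    | _         = ⊥-elim (descent (ascent⇒pairsBefore≡0 n (canonWord is js) a (canonical-ascent canonical (inj₁ a∉))))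
... | yes _    | yes a+1∈  = ⊥-elim (descent (ascent⇒pairsBefore≡0 n (canonWord is js) a (canonical-ascent canonical (inj₂ a+1∈))))
... | yes a∈   | no a+1∉   = a∈ , a+1∉

reduced-∷⁻ : ∀ {n a v} → Reduced n (a ∷ v) → Reduced n v
reduced-∷⁻ {n} {a} {v} (a-valid ∷ v-valid , minimal) = v-valid , λ u u-valid u≡v →
  ≤-pred (minimal (a ∷ u) (a-valid ∷ u-valid)
    (trans (perm≡oneLine n (a ∷ u) (a-valid ∷ u-valid))
    (trans (oneLine-∷-cong n a u v (perm≡⇒oneLine≡ u-valid v-valid u≡v))
           (sym (perm≡oneLine n (a ∷ v) (a-valid ∷ v-valid))))))

reduced⇒∼c-canonWord : ∀ {n is js} v → Canonical n is js → Reduced n v → oneLine n v ≡ oneLine n (canonWord is js) →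
                        v ∼c canonWord is js
reduced⇒∼c-canonWord [] [] _ _ = c-refl
reduced⇒∼c-canonWord {n} {is} {js} [] c@(cons _ _ _ _ _ _) _ []≡w = ⊥-elim (n≮0 (begin
  suc (length (canonWord P.is′ P.js′))   ≡⟨ sym (∼c-length P.commutes) ⟩
  length (canonWord is js)               ≡⟨ sym (inversions-canonWord c) ⟩
  inversions (oneLine n (canonWord is js)) ≡⟨ cong inversions (sym []≡w) ⟩
  inversions (oneLine n [])              ≤⟨ inversions-oneLine≤length n [] [] ⟩
  0                                      ∎))
  where
  open ≤-Reasoning
  module P = Peel (peel-head c)
reduced⇒∼c-canonWord {n} {is} {js} (a ∷ v) canonical v-reduced@(v-valid , minimal) v≡w =
  c-trans (∼c-prefix (a ∷ []) v∼w′) (∼c-sym P.commutes)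
  where
  w = canonWord is js
  w-valid = canonWord-valid canonical
  tight : length (a ∷ v) ≤ inversions (oneLine n (a ∷ v))
  tight = begin
    length (a ∷ v)              ≤⟨ minimal w w-valid (trans (perm≡oneLine n w w-valid) (trans (sym v≡w) (sym (perm≡oneLine n (a ∷ v) v-valid)))) ⟩
    length w                    ≡⟨ sym (inversions-canonWord canonical) ⟩
    inversions (oneLine n w)    ≡⟨ cong inversions (sym v≡w) ⟩
    inversions (oneLine n (a ∷ v)) ∎
    where open ≤-Reasoning
  descent : a ∈ is × ¬ suc a ∈ is
  descent = canonical-descent canonical (subst (λ l → pairsBefore (suc a) a l ≢ 0) v≡w
                                                (tight-word-starts-with-descent n a v v-valid tight))
  module P = Peel (peel canonical (proj₁ descent) (proj₂ descent))
  v∼w′ : v ∼c canonWord P.is′ P.js′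
  v∼w′ = reduced⇒∼c-canonWord v P.canonical (reduced-∷⁻ v-reduced)
           (oneLine-∷-cancel n a v (canonWord P.is′ P.js′) (trans v≡w (oneLine-∼c n P.commutes)))

canonWord-fullyCommutative : ∀ {n is js} → Canonical n is js → FCWord n (canonWord is js)
canonWord-fullyCommutative {n} canonical = canonWord-reduced canonical , λ v v-reduced v≡w →
  reduced⇒∼c-canonWord v canonical v-reduced (perm≡⇒oneLine≡ (proj₁ v-reduced) (canonWord-valid canonical) v≡w)

-- Positions of dots and nesting of arcs

top-injective : ∀ {m} {a b : Fin m} → top a ≡ top b → a ≡ b
top-injective refl = refl

bot-injective : ∀ {m} {a b : Fin m} → bot a ≡ bot b → a ≡ b
bot-injective refl = refl

top≢bot : ∀ {m} {a b : Fin m} → top a ≢ bot b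
top≢bot ()

_≟ᴰ_ : ∀ {m} → DecidableEquality (Dot m)
top a ≟ᴰ top b = map′ (cong top) top-injective (a ≟ᶠ b)
top a ≟ᴰ bot b = no top≢bot
bot a ≟ᴰ top b = no (top≢bot ∘ sym)
bot a ≟ᴰ bot b = map′ (cong bot) bot-injective (a ≟ᶠ b)

index : ∀ {m} → Dot m → ℕ
index (top x) = toℕ x
index (bot x) = toℕ x

index<m : ∀ {m} (d : Dot m) → index d < m
index<m (top x) = toℕ<n x
index<m (bot x) = toℕ<n x

top<bot : ∀ {m} (x y : Fin m) → pos (top x) < pos (bot y)
top<bot {suc n} x y = <-≤-trans (toℕ<n x) (begin
  suc n                       ≡⟨ sym (m+n∸m≡n n (suc n)) ⟩
  (n + suc n) ∸ n             ≤⟨ ∸-monoʳ-≤ (n + suc n) (≤-pred (toℕ<n y)) ⟩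
  (n + suc n) ∸ toℕ y         ∎)
  where open ≤-Reasoning

bot-pos-< : ∀ {m} (x y : Fin m) → toℕ x < toℕ y → pos (bot y) < pos (bot x)
bot-pos-< {suc n} x y x<y = ∸-monoʳ-< x<y (≤-trans (≤-pred (toℕ<n y)) (m≤m+n n (suc n)))

bot-pos-<⁻¹ : ∀ {m} (x y : Fin m) → pos (bot y) < pos (bot x) → toℕ x < toℕ y
bot-pos-<⁻¹ x y y<x with <-cmp (toℕ x) (toℕ y)
... | tri< x<y _ _ = x<y
... | tri≈ _ x≡y _ = ⊥-elim (<-irrefl (cong pos (cong bot (toℕ-injective (sym x≡y)))) y<x)
... | tri> _ _ y<x′ = ⊥-elim (<-asym y<x (bot-pos-< y x y<x′))

bot-pos-suc : ∀ {m} (x y : Fin m) → toℕ y ≡ suc (toℕ x) → pos (bot x) ≡ suc (pos (bot y))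
bot-pos-suc {suc n} x y y≡x+1 = trans (∸-suc (n + suc n) (toℕ x) x<M) (cong (λ k → suc ((n + suc n) ∸ k)) (sym y≡x+1))
  where
  ∸-suc : ∀ M k → k < M → M ∸ k ≡ suc (M ∸ suc k)
  ∸-suc (suc M) zero    _           = refl
  ∸-suc (suc M) (suc k) (s≤s k<M)   = ∸-suc M k k<M
  x<M : toℕ x < n + suc n
  x<M = <-≤-trans (subst (toℕ x <_) (sym y≡x+1) (n<1+n (toℕ x))) (≤-trans (≤-pred (toℕ<n y)) (m≤m+n n (suc n)))

pos-injective : ∀ {m} (d e : Dot m) → pos d ≡ pos e → d ≡ e
pos-injective (top x) (top y) d≡e = cong top (toℕ-injective d≡e)
pos-injective (top x) (bot y) d≡e = ⊥-elim (<-irrefl d≡e (top<bot x y))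
pos-injective (bot x) (top y) d≡e = ⊥-elim (<-irrefl (sym d≡e) (top<bot y x))
pos-injective (bot x) (bot y) d≡e with <-cmp (toℕ x) (toℕ y)
... | tri< x<y _ _ = ⊥-elim (<-irrefl (sym d≡e) (bot-pos-< x y x<y))
... | tri≈ _ x≡y _ = cong bot (toℕ-injective x≡y)
... | tri> _ _ y<x = ⊥-elim (<-irrefl d≡e (bot-pos-< y x y<x))

pos-<⇒≢ : ∀ {m} {x y : Dot m} → pos x < pos y → x ≢ y
pos-<⇒≢ x<y x≡y = <-irrefl (cong pos x≡y) x<y

data Between {m} (u v x : Dot m) : Set where
  between< : pos u < pos x → pos x < pos v → Between u v x
  between> : pos v < pos x → pos x < pos u → Between u v x

Between-sym : ∀ {m} {u v x : Dot m} → Between u v x → Between v u x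
Between-sym (between< u<x x<v) = between> u<x x<v
Between-sym (between> v<x x<u) = between< v<x x<u

not-Between-beyond : ∀ {m} {u v w : Dot m} → pos u < pos v → pos v < pos w → ¬ Between u v w
not-Between-beyond u<v v<w (between< _ w<v)   = <-asym v<w w<v
not-Between-beyond u<v v<w (between> _ w<u)   = <-asym (<-trans u<v v<w) w<u

not-Between-before : ∀ {m} {u v w : Dot m} → pos w < pos u → pos u < pos v → ¬ Between u v w
not-Between-before w<u u<v (between< u<w _)   = <-asym w<u u<w
not-Between-before w<u u<v (between> v<w _)   = <-asym (<-trans w<u u<v) v<w

module _ {m} (D : Diagram m) where

  private
    f = match D

  match-injective : ∀ {x y} → f x ≡ f y → x ≡ y
  match-injective {x} {y} fx≡fy = trans (sym (involut D x)) (trans (cong f fx≡fy) (involut D y))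

  match-flip : ∀ {x y} → f x ≡ y → f y ≡ x
  match-flip {x} refl = involut D x

  private
    crossing : ∀ {a b c d} → f a ≡ b → f c ≡ d → pos a < pos c → pos c < pos b → pos b < pos d → ⊥
    crossing refl refl a<c c<b b<d = noncross D _ _ (a<c , c<b , b<d)

    nested< : ∀ u x → x ≢ u → x ≢ f u → pos u < pos x → pos x < pos (f u) → Between u (f u) (f x)
    nested< u x x≢u x≢fu u<x x<fu with <-cmp (pos (f x)) (pos (f u)) | <-cmp (pos (f x)) (pos u)
    ... | tri> _ _ fu<fx | _             = ⊥-elim (crossing refl refl u<x x<fu fu<fx)
    ... | tri≈ _ fx≡fu _ | _             = ⊥-elim (x≢u (match-injective (pos-injective _ _ fx≡fu)))
    ... | tri< _ _ _     | tri≈ _ fx≡u _ = ⊥-elim (x≢fu (sym (match-flip (pos-injective _ _ fx≡u))))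
    ... | tri< fx<fu _ _ | tri> _ _ u<fx = between< u<fx fx<fu
    ... | tri< _ _ _     | tri< fx<u _ _ = ⊥-elim (crossing (involut D x) refl fx<u u<x x<fu)

  nested : ∀ u x → x ≢ u → x ≢ f u → Between u (f u) x → Between u (f u) (f x)
  nested u x x≢u x≢fu (between< u<x x<fu) = nested< u x x≢u x≢fu u<x x<fu
  nested u x x≢u x≢fu (between> fu<x x<u) =
    Between-sym (subst (λ v → Between (f u) v (f x)) (involut D u)
      (nested< (f u) x x≢fu (λ x≡ffu → x≢u (trans x≡ffu (involut D u))) fu<x (subst (λ y → pos x < pos y) (sym (involut D u)) x<u)))

module _ {m} (D : Diagram m) {x y : Fin m} (slant : match D (top x) ≡ bot y) (x≡y+1 : toℕ x ≡ suc (toℕ y)) where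

  private
    f = match D

    y<x : toℕ y < toℕ x
    y<x = subst (toℕ y <_) (sym x≡y+1) (n<1+n (toℕ y))

  slant-nested : ∀ z → z ≢ top x → z ≢ bot y → Between (top x) (bot y) z → Between (top x) (bot y) (f z)
  slant-nested z z≢x z≢y x…y = subst (λ d → Between (top x) d (f z)) slant
    (nested D (top x) z z≢x (subst (z ≢_) (sym slant) z≢y) (subst (λ d → Between (top x) d z) (sym slant) x…y))

  bot-under-slant : Between (top x) (bot y) (f (bot x))
  bot-under-slant = slant-nested (bot x) (top≢bot ∘ sym) (pos-<⇒≢ (bot-pos-< y x y<x)) (between< (top<bot x x) (bot-pos-< y x y<x))

  slant-not-last : (∀ (w : Fin m) → toℕ w ≤ toℕ x) → ⊥
  slant-not-last last = by-partner (f (bot x)) refl bot-under-slant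
    where
    by-partner : ∀ z → f (bot x) ≡ z → Between (top x) (bot y) z → ⊥
    by-partner (top w) _  (between< x<w _) = <⇒≱ x<w (last w)
    by-partner (top w) _  (between> y<w _) = <-asym y<w (top<bot w y)
    by-partner (bot w) eq (between< _ w<y) =
      nofix D (bot x) (trans eq (cong bot (toℕ-injective (≤-antisym (last w) (subst (_≤ toℕ w) (sym x≡y+1) (bot-pos-<⁻¹ y w w<y))))))
    by-partner (bot w) _  (between> _ w<x) = <-asym w<x (top<bot x w)

  slant-not-beside-vertical : ∀ {x₁} → toℕ x₁ ≡ suc (toℕ x) → f (top x₁) ≢ bot x₁
  slant-not-beside-vertical {x₁} x₁≡x+1 x₁↕ = by-partner (f (bot x)) refl bot-under-slant
    where
    x<x₁ : toℕ x < toℕ x₁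
    x<x₁ = subst (toℕ x <_) (sym x₁≡x+1) (n<1+n _)
    bx≡bx₁+1 : pos (bot x) ≡ suc (pos (bot x₁))
    bx≡bx₁+1 = bot-pos-suc x x₁ x₁≡x+1
    bx-outside : ¬ Between (top x₁) (bot x₁) (bot x)
    bx-outside (between< _ bx<bx₁) = <-asym bx<bx₁ (subst (pos (bot x₁) <_) (sym bx≡bx₁+1) (n<1+n _))
    bx-outside (between> _ bx<x₁)  = <-asym bx<x₁ (top<bot x₁ x)
    trapped : ∀ z → f z ≡ bot x → pos z ≢ pos (bot x) → Between (top x) (bot y) z → ⊥
    trapped z fz≡bx z≢bx (between> y<z z<x) = <-asym (<-trans y<z z<x) (top<bot x y)
    trapped z fz≡bx z≢bx (between< x<z z<y) with <-cmp (pos z) (pos (top x₁)) | <-cmp (pos z) (pos (bot x₁))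
    ... | tri< z<x₁ _ _ | _ = <⇒≱ z<x₁ (subst (_≤ pos z) (sym x₁≡x+1) x<z)
    ... | tri≈ _ z≡x₁ _ | _ = pos-<⇒≢ (bot-pos-< x x₁ x<x₁) (trans (sym x₁↕) (trans (cong f (pos-injective _ _ (sym z≡x₁))) fz≡bx))
    ... | tri> _ _ _ | tri≈ _ z≡bx₁ _ = top≢bot (trans (sym (match-flip D x₁↕)) (trans (cong f (pos-injective _ _ (sym z≡bx₁))) fz≡bx))
    ... | tri> _ _ x₁<z | tri< z<bx₁ _ _ = bx-outside (subst (Between (top x₁) (bot x₁)) fz≡bx
          (subst (λ d → Between (top x₁) d (f z)) x₁↕
            (nested D (top x₁) z (pos-<⇒≢ x₁<z ∘ sym) (subst (z ≢_) (sym x₁↕) (pos-<⇒≢ z<bx₁))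
              (subst (λ d → Between (top x₁) d z) (sym x₁↕) (between< x₁<z z<bx₁)))))
    ... | tri> _ _ _ | tri> _ _ bx₁<z =
      z≢bx (≤-antisym (≤-pred (subst (pos z <_) (bot-pos-suc y x x≡y+1) z<y)) (subst (_≤ pos z) (sym bx≡bx₁+1) bx₁<z))
    by-partner : ∀ z → f (bot x) ≡ z → Between (top x) (bot y) z → ⊥
    by-partner z eq = trapped z (trans (cong f (sym eq)) (involut D (bot x))) (λ z≡bx → nofix D (bot x) (trans eq (pos-injective _ _ z≡bx)))

-- Opening a cap

-- The arcs α–β and Q–P become α–P and β–Q. This stays non-crossing because β is the dot right after
-- α, the dots strictly between β and Q are joined among themselves, and P lies outside [α, Q].
module OpenCap {m} (D : Diagram m) (α β Q : Dot m)
               (α↔β : match D α ≡ β) (β-next : pos β ≡ suc (pos α)) (β<Q : pos β < pos Q)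
               (P-outside : pos (match D Q) < pos α ⊎ pos Q < pos (match D Q))
               (β…Q-closed : ∀ (x : Dot m) → pos β < pos x → pos x < pos Q → pos β < pos (match D x) × pos (match D x) < pos Q)
               where

  private
    f = match D

  P : Dot m
  P = f Q

  α<β : pos α < pos β
  α<β = ≤-reflexive (sym β-next)

  α<Q : pos α < pos Q
  α<Q = <-trans α<β β<Q

  after-α : ∀ {x} → pos α < pos x → x ≢ β → pos β < pos x
  after-α {x} α<x x≢β = ≤∧≢⇒< (subst (_≤ pos x) (sym β-next) α<x) (λ β≡x → x≢β (pos-injective _ _ (sym β≡x)))

  P-not-inside : pos α < pos P → pos P < pos Q → ⊥
  P-not-inside α<P P<Q = [ <-asym α<P , <-asym P<Q ]′ P-outside

  β↔α : f β ≡ α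
  β↔α = match-flip D α↔β

  P↔Q : f P ≡ Q
  P↔Q = involut D Q

  P≢α : P ≢ α
  P≢α = [ pos-<⇒≢ , (λ Q<P → pos-<⇒≢ (<-trans α<Q Q<P) ∘ sym) ]′ P-outside

  P≢β : P ≢ β
  P≢β = [ (λ P<α → pos-<⇒≢ (<-trans P<α α<β)) , (λ Q<P → pos-<⇒≢ (<-trans β<Q Q<P) ∘ sym) ]′ P-outside

  Q≢α : Q ≢ α
  Q≢α = pos-<⇒≢ α<Q ∘ sym

  Q≢β : Q ≢ β
  Q≢β = pos-<⇒≢ β<Q ∘ sym

  g : Dot m → Dot m
  g x with x ≟ᴰ α | x ≟ᴰ β | x ≟ᴰ P | x ≟ᴰ Q
  ... | yes _ | _     | _     | _     = P
  ... | no _  | yes _ | _     | _     = Q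
  ... | no _  | no _  | yes _ | _     = α
  ... | no _  | no _  | no _  | yes _ = β
  ... | no _  | no _  | no _  | no _  = f x

  Old : Dot m → Set
  Old x = x ≢ α × x ≢ β × x ≢ P × x ≢ Q

  g-α : g α ≡ P
  g-α with α ≟ᴰ α | α ≟ᴰ β | α ≟ᴰ P | α ≟ᴰ Q
  ... | yes _   | _ | _ | _ = refl
  ... | no α≢α  | _ | _ | _ = ⊥-elim (α≢α refl)

  g-β : g β ≡ Q
  g-β with β ≟ᴰ α | β ≟ᴰ β | β ≟ᴰ P | β ≟ᴰ Q
  ... | yes β≡α | _      | _ | _ = ⊥-elim (pos-<⇒≢ α<β (sym β≡α))
  ... | no _    | yes _  | _ | _ = refl
  ... | no _    | no β≢β | _ | _ = ⊥-elim (β≢β refl)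

  g-P : g P ≡ α
  g-P with P ≟ᴰ α | P ≟ᴰ β | P ≟ᴰ P | P ≟ᴰ Q
  ... | yes P≡α | _       | _      | _ = ⊥-elim (P≢α P≡α)
  ... | no _    | yes P≡β | _      | _ = ⊥-elim (P≢β P≡β)
  ... | no _    | no _    | yes _  | _ = refl
  ... | no _    | no _    | no P≢P | _ = ⊥-elim (P≢P refl)

  g-Q : g Q ≡ β
  g-Q with Q ≟ᴰ α | Q ≟ᴰ β | Q ≟ᴰ P | Q ≟ᴰ Q
  ... | yes Q≡α | _       | _       | _      = ⊥-elim (Q≢α Q≡α)
  ... | no _    | yes Q≡β | _       | _      = ⊥-elim (Q≢β Q≡β)
  ... | no _    | no _    | yes Q≡P | _      = ⊥-elim (nofix D Q (sym Q≡P))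
  ... | no _    | no _    | no _    | yes _  = refl
  ... | no _    | no _    | no _    | no Q≢Q = ⊥-elim (Q≢Q refl)

  g-old : ∀ {x} → Old x → g x ≡ f x
  g-old {x} (x≢α , x≢β , x≢P , x≢Q) with x ≟ᴰ α | x ≟ᴰ β | x ≟ᴰ P | x ≟ᴰ Q
  ... | yes x≡α | _       | _       | _       = ⊥-elim (x≢α x≡α)
  ... | no _    | yes x≡β | _       | _       = ⊥-elim (x≢β x≡β)
  ... | no _    | no _    | yes x≡P | _       = ⊥-elim (x≢P x≡P)
  ... | no _    | no _    | no _    | yes x≡Q = ⊥-elim (x≢Q x≡Q)
  ... | no _    | no _    | no _    | no _    = refl

  data New (x : Dot m) : Set where
    is-α : x ≡ α → New x
    is-β : x ≡ β → New x
    is-P : x ≡ P → New x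
    is-Q : x ≡ Q → New x

  role : ∀ x → New x ⊎ Old x
  role x with x ≟ᴰ α | x ≟ᴰ β | x ≟ᴰ P | x ≟ᴰ Q
  ... | yes x≡α | _       | _       | _       = inj₁ (is-α x≡α)
  ... | no _    | yes x≡β | _       | _       = inj₁ (is-β x≡β)
  ... | no _    | no _    | yes x≡P | _       = inj₁ (is-P x≡P)
  ... | no _    | no _    | no _    | yes x≡Q = inj₁ (is-Q x≡Q)
  ... | no x≢α  | no x≢β  | no x≢P  | no x≢Q  = inj₂ (x≢α , x≢β , x≢P , x≢Q)

  Old-f : ∀ {x} → Old x → Old (f x)
  Old-f {x} (x≢α , x≢β , x≢P , x≢Q) =
    (λ fx≡α → x≢β (trans (sym (match-flip D fx≡α)) α↔β)) ,
    (λ fx≡β → x≢α (trans (sym (match-flip D fx≡β)) β↔α)) ,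
    (λ fx≡P → x≢Q (trans (sym (match-flip D fx≡P)) P↔Q)) ,
    (λ fx≡Q → x≢P (sym (match-flip D fx≡Q)))

  g-involutive : ∀ x → g (g x) ≡ x
  g-involutive x with role x
  ... | inj₁ (is-α refl) = trans (cong g g-α) g-P
  ... | inj₁ (is-β refl) = trans (cong g g-β) g-Q
  ... | inj₁ (is-P refl) = trans (cong g g-P) g-α
  ... | inj₁ (is-Q refl) = trans (cong g g-Q) g-β
  ... | inj₂ old         = trans (cong g (g-old old)) (trans (g-old (Old-f old)) (involut D x))

  g-nofix : ∀ x → g x ≢ x
  g-nofix x gx≡x with role x
  ... | inj₁ (is-α refl) = P≢α (trans (sym g-α) gx≡x)
  ... | inj₁ (is-β refl) = Q≢β (trans (sym g-β) gx≡x)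
  ... | inj₁ (is-P refl) = P≢α (sym (trans (sym g-P) gx≡x))
  ... | inj₁ (is-Q refl) = Q≢β (sym (trans (sym g-Q) gx≡x))
  ... | inj₂ old         = nofix D x (trans (sym (g-old old)) gx≡x)

  α…P-nested : ∀ x → Old x → Between α P x → Between α P (f x)
  α…P-nested x (x≢α , x≢β , x≢P , x≢Q) = [ P-left , P-right ]′ P-outside
    where
    P-left : pos P < pos α → Between α P x → Between α P (f x)
    P-left P<α (between< α<x x<P) = ⊥-elim (<-asym P<α (<-trans α<x x<P))
    P-left P<α (between> P<x x<α) with nested D Q x x≢Q x≢P (between> P<x (<-trans x<α α<Q))
    ... | between< Q<fx fx<P = ⊥-elim (<-asym (<-trans P<α α<Q) (<-trans Q<fx fx<P))
    ... | between> P<fx fx<Q with <-cmp (pos (f x)) (pos α)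
    ...   | tri< fx<α _ _ = between> P<fx fx<α
    ...   | tri≈ _ fx≡α _ = ⊥-elim (x≢β (trans (sym (match-flip D (pos-injective _ _ fx≡α))) α↔β))
    ...   | tri> _ _ α<fx = ⊥-elim (<-asym (<-trans x<α α<β) (subst (λ y → pos β < pos y) (involut D x) β<ffx))
      where
      β<ffx = proj₁ (β…Q-closed (f x) (after-α α<fx (λ fx≡β → x≢α (trans (sym (match-flip D fx≡β)) β↔α))) fx<Q)
    P-right : pos Q < pos P → Between α P x → Between α P (f x)
    P-right Q<P (between> P<x x<α) = ⊥-elim (<-asym (<-trans α<Q Q<P) (<-trans P<x x<α))
    P-right Q<P (between< α<x x<P) with <-cmp (pos x) (pos Q)
    ... | tri< x<Q _ _ = let β<fx , fx<Q = β…Q-closed x (after-α α<x x≢β) x<Q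
                         in between< (<-trans α<β β<fx) (<-trans fx<Q Q<P)
    ... | tri≈ _ x≡Q _ = ⊥-elim (x≢Q (pos-injective _ _ x≡Q))
    ... | tri> _ _ Q<x with nested D Q x x≢Q x≢P (between< Q<x x<P)
    ...   | between< Q<fx fx<P = between< (<-trans α<Q Q<fx) fx<P
    ...   | between> P<fx fx<Q = ⊥-elim (<-asym Q<P (<-trans P<fx fx<Q))

  β…Q-nested : ∀ x → Between β Q x → Between β Q (f x)
  β…Q-nested x (between< β<x x<Q) = let β<fx , fx<Q = β…Q-closed x β<x x<Q in between< β<fx fx<Q
  β…Q-nested x (between> Q<x x<β) = ⊥-elim (<-asym β<Q (<-trans Q<x x<β))

  new-arc-nested : ∀ {u} x → New u → Old x → Between u (g u) x → Between u (g u) (f x)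
  new-arc-nested x (is-α refl) old rewrite g-α = α…P-nested x old
  new-arc-nested x (is-P refl) old rewrite g-P = Between-sym ∘ α…P-nested x old ∘ Between-sym
  new-arc-nested x (is-β refl) old rewrite g-β = β…Q-nested x
  new-arc-nested x (is-Q refl) old rewrite g-Q = Between-sym ∘ β…Q-nested x ∘ Between-sym

  new-arcs-noncrossing : ∀ {a c} → New a → New c → ¬ (pos a < pos c × pos c < pos (g a) × pos (g a) < pos (g c))
  new-arcs-noncrossing (is-α refl) (is-α refl) (α<α , _) = <-irrefl refl α<α
  new-arcs-noncrossing (is-α refl) (is-β refl) (_ , β<P , P<Q) rewrite g-α | g-β = P-not-inside (<-trans α<β β<P) P<Q
  new-arcs-noncrossing (is-α refl) (is-P refl) (_ , P<P , _) rewrite g-α = <-irrefl refl P<P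
  new-arcs-noncrossing (is-α refl) (is-Q refl) (_ , Q<P , P<β) rewrite g-α | g-Q = <-asym β<Q (<-trans Q<P P<β)
  new-arcs-noncrossing (is-β refl) (is-α refl) (β<α , _) = <-asym α<β β<α
  new-arcs-noncrossing (is-β refl) (is-β refl) (β<β , _) = <-irrefl refl β<β
  new-arcs-noncrossing (is-β refl) (is-P refl) (_ , P<Q , Q<α) rewrite g-β | g-P = <-asym α<Q Q<α
  new-arcs-noncrossing (is-β refl) (is-Q refl) (_ , Q<Q , _) rewrite g-β = <-irrefl refl Q<Q
  new-arcs-noncrossing (is-P refl) (is-α refl) (_ , α<α , _) rewrite g-P = <-irrefl refl α<α
  new-arcs-noncrossing (is-P refl) (is-β refl) (_ , β<α , _) rewrite g-P = <-asym α<β β<α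
  new-arcs-noncrossing (is-P refl) (is-P refl) (P<P , _) = <-irrefl refl P<P
  new-arcs-noncrossing (is-P refl) (is-Q refl) (_ , Q<α , _) rewrite g-P = <-asym α<Q Q<α
  new-arcs-noncrossing (is-Q refl) (is-α refl) (Q<α , _) = <-asym α<Q Q<α
  new-arcs-noncrossing (is-Q refl) (is-β refl) (_ , β<β , _) rewrite g-Q = <-irrefl refl β<β
  new-arcs-noncrossing (is-Q refl) (is-P refl) (Q<P , P<β , _) rewrite g-Q = <-asym β<Q (<-trans Q<P P<β)
  new-arcs-noncrossing (is-Q refl) (is-Q refl) (Q<Q , _) = <-irrefl refl Q<Q

  g-noncrossing : ∀ a c → ¬ (pos a < pos c × pos c < pos (g a) × pos (g a) < pos (g c))
  g-noncrossing a c (a<c , c<ga , ga<gc) with role a | role c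
  ... | inj₁ new-a | inj₁ new-c = new-arcs-noncrossing new-a new-c (a<c , c<ga , ga<gc)
  ... | inj₁ new-a | inj₂ old-c =
    not-Between-beyond (<-trans a<c c<ga) (subst (λ y → pos (g a) < pos y) (g-old old-c) ga<gc)
      (new-arc-nested c new-a old-c (between< a<c c<ga))
  ... | inj₂ old-a | inj₁ new-c =
    not-Between-before a<c (<-trans c<ga ga<gc)
      (subst (Between c (g c)) (involut D a)
        (new-arc-nested (f a) new-c (Old-f old-a) (subst (Between c (g c)) (g-old old-a) (between< c<ga ga<gc))))
  ... | inj₂ old-a | inj₂ old-c =
    noncross D a c (a<c , subst (λ y → pos c < pos y) (g-old old-a) c<ga , subst₂ (λ y z → pos y < pos z) (g-old old-a) (g-old old-c) ga<gc)

  opened : Diagram m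
  opened = record { match = g ; involut = g-involutive ; nofix = g-nofix ; noncross = g-noncrossing }

module _ {m : ℕ} (f g : Dot m → Dot m) where

  concatD-top-top : ∀ {a b} → f (top a) ≡ top b → concatD f g (top a) ≡ top b
  concatD-top-top {a} eq with f (top a) | eq
  ... | _ | refl = refl

  concatD-top-bot : ∀ {a b} → f (top a) ≡ bot b → concatD f g (top a) ≡ goG f g (suc (m + m)) b
  concatD-top-bot {a} eq with f (top a) | eq
  ... | _ | refl = refl

  concatD-bot-bot : ∀ {a b} → g (bot a) ≡ bot b → concatD f g (bot a) ≡ bot b
  concatD-bot-bot {a} eq with g (bot a) | eq
  ... | _ | refl = refl

  concatD-bot-top : ∀ {a b} → g (bot a) ≡ top b → concatD f g (bot a) ≡ goF f g (suc (m + m)) b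
  concatD-bot-top {a} eq with g (bot a) | eq
  ... | _ | refl = refl

  goG-exit : ∀ {k b c} → g (top b) ≡ bot c → goG f g (suc k) b ≡ bot c
  goG-exit {b = b} eq with g (top b) | eq
  ... | _ | refl = refl

  goG-turn : ∀ {k b c} → g (top b) ≡ top c → goG f g (suc k) b ≡ goF f g k c
  goG-turn {b = b} eq with g (top b) | eq
  ... | _ | refl = refl

  goF-exit : ∀ {k c d} → f (bot c) ≡ top d → goF f g (suc k) c ≡ top d
  goF-exit {c = c} eq with f (bot c) | eq
  ... | _ | refl = refl

  goF-turn : ∀ {k c d} → f (bot c) ≡ bot d → goF f g (suc k) c ≡ goG f g k d
  goF-turn {c = c} eq with f (bot c) | eq
  ... | _ | refl = refl

module _ {m : ℕ} (f g g′ : Dot m → Dot m) (g≗g′ : ∀ x → g x ≡ g′ x) where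

  mutual
    goG-cong : ∀ k b → goG f g k b ≡ goG f g′ k b
    goG-cong zero    b = refl
    goG-cong (suc k) b = by-cases (g (top b)) refl
      where
      by-cases : ∀ r → g (top b) ≡ r → goG f g (suc k) b ≡ goG f g′ (suc k) b
      by-cases (bot c) eq = trans (goG-exit f g eq) (sym (goG-exit f g′ (trans (sym (g≗g′ (top b))) eq)))
      by-cases (top c) eq = trans (goG-turn f g eq) (trans (goF-cong k c) (sym (goG-turn f g′ (trans (sym (g≗g′ (top b))) eq))))

    goF-cong : ∀ k c → goF f g k c ≡ goF f g′ k c
    goF-cong zero    c = refl
    goF-cong (suc k) c = by-cases (f (bot c)) refl
      where
      by-cases : ∀ r → f (bot c) ≡ r → goF f g (suc k) c ≡ goF f g′ (suc k) c
      by-cases (top d) eq = trans (goF-exit f g eq) (sym (goF-exit f g′ eq))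
      by-cases (bot d) eq = trans (goF-turn f g eq) (trans (goG-cong k d) (sym (goF-turn f g′ eq)))

  concatD-cong : ∀ x → concatD f g x ≡ concatD f g′ x
  concatD-cong (top a) = by-cases (f (top a)) refl
    where
    by-cases : ∀ r → f (top a) ≡ r → concatD f g (top a) ≡ concatD f g′ (top a)
    by-cases (top b) eq = trans (concatD-top-top f g eq) (sym (concatD-top-top f g′ eq))
    by-cases (bot b) eq = trans (concatD-top-bot f g eq) (trans (goG-cong (suc (m + m)) b) (sym (concatD-top-bot f g′ eq)))
  concatD-cong (bot a) = by-cases (g (bot a)) refl
    where
    by-cases : ∀ r → g (bot a) ≡ r → concatD f g (bot a) ≡ concatD f g′ (bot a)
    by-cases (bot c) eq = trans (concatD-bot-bot f g eq) (sym (concatD-bot-bot f g′ (trans (sym (g≗g′ (bot a))) eq)))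
    by-cases (top c) eq = trans (concatD-bot-top f g eq) (trans (goF-cong (suc (m + m)) c) (sym (concatD-bot-top f g′ (trans (sym (g≗g′ (bot a))) eq))))

nbr-lower : ∀ {m} k (x y : Fin m) → toℕ x ≡ k → toℕ y ≡ suc k → nbr k x ≡ just y
nbr-lower zero    fzero    (fsuc fzero) refl refl = refl
nbr-lower {suc (suc m)} (suc k) (fsuc x) (fsuc y) x≡k+1 y≡k+2 = cong (Maybe.map fsuc) (nbr-lower k x y (suc-injective x≡k+1) (suc-injective y≡k+2))

nbr-upper : ∀ {m} k (x y : Fin m) → toℕ x ≡ k → toℕ y ≡ suc k → nbr k y ≡ just x
nbr-upper zero    fzero    (fsuc fzero) refl refl = refl
nbr-upper {suc (suc m)} (suc k) (fsuc x) (fsuc y) x≡k+1 y≡k+2 = cong (Maybe.map fsuc) (nbr-upper k x y (suc-injective x≡k+1) (suc-injective y≡k+2))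

nbr-away : ∀ {m} k (x : Fin m) → toℕ x ≢ k → toℕ x ≢ suc k → nbr k x ≡ nothing
nbr-away {suc (suc m)} zero    fzero               x≢0 _   = ⊥-elim (x≢0 refl)
nbr-away {suc (suc m)} zero    (fsuc fzero)        _   x≢1 = ⊥-elim (x≢1 refl)
nbr-away {suc (suc m)} zero    (fsuc (fsuc x))     _   _   = refl
nbr-away {suc zero}    zero    fzero               x≢0 _   = ⊥-elim (x≢0 refl)
nbr-away {suc zero}    (suc k) fzero               _   _   = refl
nbr-away {suc (suc m)} (suc k) fzero               _   _   = refl
nbr-away {suc (suc m)} (suc k) (fsuc x)            x≢k+1 x≢k+2 =
  cong (Maybe.map fsuc) (nbr-away k x (x≢k+1 ∘ cong suc) (x≢k+2 ∘ cong suc))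

module _ {m c : ℕ} {c0 c1 : Fin m} (c0≡c : toℕ c0 ≡ c) (c1≡c+1 : toℕ c1 ≡ suc c) where

  E-top-lower : E (suc c) (top c0) ≡ top c1
  E-top-lower rewrite nbr-lower c c0 c1 c0≡c c1≡c+1 = refl

  E-bot-lower : E (suc c) (bot c0) ≡ bot c1
  E-bot-lower rewrite nbr-lower c c0 c1 c0≡c c1≡c+1 = refl

  E-top-upper : E (suc c) (top c1) ≡ top c0
  E-top-upper rewrite nbr-upper c c0 c1 c0≡c c1≡c+1 = refl

  E-bot-upper : E (suc c) (bot c1) ≡ bot c0
  E-bot-upper rewrite nbr-upper c c0 c1 c0≡c c1≡c+1 = refl

  private
    nbr-away′ : ∀ s → s ≢ c0 → s ≢ c1 → nbr c s ≡ nothing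
    nbr-away′ s s≢c0 s≢c1 = nbr-away c s (λ s≡c → s≢c0 (toℕ-injective (trans s≡c (sym c0≡c))))
                                         (λ s≡c+1 → s≢c1 (toℕ-injective (trans s≡c+1 (sym c1≡c+1))))

  E-top-away : ∀ s → s ≢ c0 → s ≢ c1 → E (suc c) (top s) ≡ bot s
  E-top-away s s≢c0 s≢c1 rewrite nbr-away′ s s≢c0 s≢c1 = refl

  E-bot-away : ∀ s → s ≢ c0 → s ≢ c1 → E (suc c) (bot s) ≡ top s
  E-bot-away s s≢c0 s≢c1 rewrite nbr-away′ s s≢c0 s≢c1 = refl

-- A path of e ∗ D′ that bounces off the cap c0–c1 of e enters D′ at the other cap dot, and from
-- there it leaves for good: D′ cannot lead it back to the cap.
module ConcatCap {k : ℕ} (e : Dot (suc (suc k)) → Dot (suc (suc k))) (D′ : Diagram (suc (suc k)))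
                 (c0 c1 : Fin (suc (suc k)))
                 (e-cap-top : e (top c0) ≡ top c1) (e-cap-bot : e (bot c0) ≡ bot c1)
                 (e-top-away : ∀ (s : Fin (suc (suc k))) → s ≢ c0 → s ≢ c1 → e (top s) ≡ bot s)
                 (e-bot-away : ∀ (s : Fin (suc (suc k))) → s ≢ c0 → s ≢ c1 → e (bot s) ≡ top s)
                 where

  private
    h = match D′

    continue : ∀ K → h (top c0) ≢ top c1 → goF e h (suc (suc (suc K))) c0 ≡ h (top c1)
    continue K c0↮c1 = trans (goF-turn e h e-cap-bot) (by-cases (h (top c1)) refl)
      where
      by-cases : ∀ r → h (top c1) ≡ r → goG e h (suc (suc K)) c1 ≡ h (top c1)
      by-cases (bot z) eq = trans (goG-exit e h eq) (sym eq)
      by-cases (top u) eq = trans (goG-turn e h eq) (trans (goF-exit e h (e-bot-away u u≢c0 u≢c1)) (sym eq))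
        where
        u≢c0 : u ≢ c0
        u≢c0 refl = c0↮c1 (match-flip D′ eq)
        u≢c1 : u ≢ c1
        u≢c1 refl = nofix D′ (top c1) eq

  at-cap : concatD e h (top c0) ≡ top c1
  at-cap = concatD-top-top e h e-cap-top

  through-top : ∀ a → a ≢ c0 → a ≢ c1 → (∀ s → h (top a) ≡ top s → s ≢ c0 × s ≢ c1) → concatD e h (top a) ≡ h (top a)
  through-top a a≢c0 a≢c1 avoids = trans (concatD-top-bot e h (e-top-away a a≢c0 a≢c1)) (by-cases (h (top a)) refl)
    where
    by-cases : ∀ r → h (top a) ≡ r → goG e h (suc (suc (suc k) + suc (suc k))) a ≡ h (top a)
    by-cases (bot z) eq = trans (goG-exit e h eq) (sym eq)
    by-cases (top s) eq = trans (goG-turn e h eq) (trans (goF-exit e h (e-bot-away s (proj₁ (avoids s eq)) (proj₂ (avoids s eq)))) (sym eq))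

  through-bot : ∀ a → (∀ s → h (bot a) ≡ top s → s ≢ c0 × s ≢ c1) → concatD e h (bot a) ≡ h (bot a)
  through-bot a avoids = by-cases (h (bot a)) refl
    where
    by-cases : ∀ r → h (bot a) ≡ r → concatD e h (bot a) ≡ h (bot a)
    by-cases (bot z) eq = trans (concatD-bot-bot e h eq) (sym eq)
    by-cases (top s) eq = trans (concatD-bot-top e h eq) (trans (goF-exit e h (e-bot-away s (proj₁ (avoids s eq)) (proj₂ (avoids s eq)))) (sym eq))

  bounce-top : ∀ a → a ≢ c0 → a ≢ c1 → h (top a) ≡ top c0 → concatD e h (top a) ≡ h (top c1)
  bounce-top a a≢c0 a≢c1 eq = begin
    concatD e h (top a)                         ≡⟨ concatD-top-bot e h (e-top-away a a≢c0 a≢c1) ⟩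
    goG e h (suc (suc (suc k) + suc (suc k))) a ≡⟨ goG-turn e h eq ⟩
    goF e h (suc (suc k + suc (suc k))) c0      ≡⟨ cong (λ K → goF e h (suc (suc K)) c0) (+-suc k (suc k)) ⟩
    goF e h (suc (suc (suc (k + suc k)))) c0    ≡⟨ continue (k + suc k) (a≢c1 ∘ top-injective ∘ trans (sym (match-flip D′ eq))) ⟩
    h (top c1)                                  ∎
    where open ≡-Reasoning

  bounce-bot : ∀ a → h (bot a) ≡ top c0 → concatD e h (bot a) ≡ h (top c1)
  bounce-bot a eq = trans (concatD-bot-top e h eq) (continue (k + suc (suc k)) (top≢bot ∘ sym ∘ trans (sym (match-flip D′ eq))))

-- Tails and heads

module _ {A : Set} (p : A → Bool) where

  filterᵇ-accept : ∀ {k ks} → p k ≡ true → filterᵇ p (k ∷ ks) ≡ k ∷ filterᵇ p ks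
  filterᵇ-accept pk≡true = filter-accept (T? ∘ p) (subst T (sym pk≡true) tt)

  filterᵇ-reject : ∀ {k ks} → p k ≡ false → filterᵇ p (k ∷ ks) ≡ filterᵇ p ks
  filterᵇ-reject pk≡false = filter-reject (T? ∘ p) (subst T pk≡false)

module _ (p : ℕ → Bool) where

  filter-downFrom-skip : ∀ {m c} → c ≤ m → (∀ k → c ≤ k → k < m → p k ≡ false) → filterᵇ p (downFrom m) ≡ filterᵇ p (downFrom c)
  filter-downFrom-skip {zero}  z≤n _ = refl
  filter-downFrom-skip {suc m} c≤m+1 false-above with m≤n⇒m<n∨m≡n c≤m+1
  ... | inj₂ refl = refl
  ... | inj₁ c<m+1 = trans (filterᵇ-reject p (false-above m (≤-pred c<m+1) ≤-refl))
                           (filter-downFrom-skip (≤-pred c<m+1) (λ k c≤k k<m → false-above k c≤k (m<n⇒m<1+n k<m)))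

  filter-downFrom-below : ∀ c → All (_< c) (filterᵇ p (downFrom c))
  filter-downFrom-below c = filter⁺ (T? ∘ p) (applyDownFrom⁺₁ (λ k → k) c (λ k<c → k<c))

  largest-true : ∀ m → (∀ k → k < m → p k ≡ false) ⊎ Σ ℕ (λ c → c < m × p c ≡ true × (∀ k → c < k → k < m → p k ≡ false))
  largest-true zero    = inj₁ (λ k ())
  largest-true (suc m) with p m in pm
  ... | true  = inj₂ (m , ≤-refl , pm , λ k m<k k<m+1 → ⊥-elim (<⇒≱ m<k (≤-pred k<m+1)))
  ... | false with largest-true m
  ...   | inj₁ none      = inj₁ (λ k k<m+1 → [ (λ k<m → none k k<m) , (λ { refl → pm }) ]′ (m≤n⇒m<n∨m≡n (≤-pred k<m+1)))
  ...   | inj₂ (c , c<m , pc , none-above) =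
    inj₂ (c , m<n⇒m<1+n c<m , pc , λ k c<k k<m+1 → [ none-above k c<k , (λ { refl → pm }) ]′ (m≤n⇒m<n∨m≡n (≤-pred k<m+1)))

filter-downFrom-cong : ∀ (p q : ℕ → Bool) c → (∀ k → k < c → p k ≡ q k) → filterᵇ p (downFrom c) ≡ filterᵇ q (downFrom c)
filter-downFrom-cong p q zero    p≗q = refl
filter-downFrom-cong p q (suc c) p≗q = by-cases (p c) refl
  where
  rest = filter-downFrom-cong p q c (λ k k<c → p≗q k (m<n⇒m<1+n k<c))
  by-cases : ∀ b → p c ≡ b → filterᵇ p (downFrom (suc c)) ≡ filterᵇ q (downFrom (suc c))
  by-cases true  pc = trans (filterᵇ-accept p pc) (trans (cong (c ∷_) rest) (sym (filterᵇ-accept q (trans (sym (p≗q c ≤-refl)) pc))))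
  by-cases false pc = trans (filterᵇ-reject p pc) (trans rest (sym (filterᵇ-reject q (trans (sym (p≗q c ≤-refl)) pc))))

every-index : ∀ {m} (P : ℕ → Set) → (∀ (x : Fin m) → P (toℕ x)) → ∀ j → j < m → P j
every-index P P-at j j<m = subst P (toℕ-fromℕ< j<m) (P-at (fromℕ< j<m))

-- false for k ≥ m
onℕ : ∀ {m} → (Fin m → Bool) → ℕ → Bool
onℕ {m} q k with k <? m
... | yes k<m = q (fromℕ< k<m)
... | no _    = false

onℕ-toℕ : ∀ {m} (q : Fin m → Bool) x → onℕ q (toℕ x) ≡ q x
onℕ-toℕ {m} q x with toℕ x <? m
... | yes x<m = cong q (fromℕ<-toℕ x x<m)
... | no x≮m  = ⊥-elim (x≮m (toℕ<n x))

onℕ-at : ∀ {m} (q : Fin m → Bool) {x k} → toℕ x ≡ k → onℕ q k ≡ q x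
onℕ-at q {x} refl = onℕ-toℕ q x

map-toℕ-filterᵇ : ∀ {m} (q : Fin m → Bool) xs → map toℕ (filterᵇ q xs) ≡ filterᵇ (onℕ q) (map toℕ xs)
map-toℕ-filterᵇ q []       = refl
map-toℕ-filterᵇ q (x ∷ xs) = by-cases (q x) refl
  where
  by-cases : ∀ b → q x ≡ b → map toℕ (filterᵇ q (x ∷ xs)) ≡ filterᵇ (onℕ q) (map toℕ (x ∷ xs))
  by-cases true  qx = trans (cong (map toℕ) (filterᵇ-accept q qx))
    (trans (cong (toℕ x ∷_) (map-toℕ-filterᵇ q xs)) (sym (filterᵇ-accept (onℕ q) (trans (onℕ-toℕ q x) qx))))
  by-cases false qx = trans (cong (map toℕ) (filterᵇ-reject q qx))
    (trans (map-toℕ-filterᵇ q xs) (sym (filterᵇ-reject (onℕ q) (trans (onℕ-toℕ q x) qx))))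

tabulate≡applyUpTo : ∀ n (f : Fin n → ℕ) (g : ℕ → ℕ) → (∀ i → f i ≡ g (toℕ i)) → tabulate f ≡ applyUpTo g n
tabulate≡applyUpTo zero    f g f≗g = refl
tabulate≡applyUpTo (suc n) f g f≗g = cong₂ _∷_ (f≗g fzero) (tabulate≡applyUpTo n (f ∘ fsuc) (g ∘ suc) (f≗g ∘ fsuc))

map-toℕ-reverse-allFin : ∀ m → map toℕ (reverse (allFin m)) ≡ downFrom m
map-toℕ-reverse-allFin m = begin
  map toℕ (reverse (allFin m))     ≡⟨ reverse-map toℕ (allFin m) ⟩
  reverse (map toℕ (allFin m))     ≡⟨ cong reverse (trans (map-tabulate (λ i → i) toℕ) (tabulate≡applyUpTo m toℕ (λ k → k) (λ i → refl))) ⟩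
  reverse (upTo m)                 ≡⟨ reverse-upTo m ⟩
  downFrom m                       ∎
  where open ≡-Reasoning

tailℕ : ∀ {m} → (Dot m → Dot m) → ℕ → Bool
tailℕ f = onℕ (isTailB f)

headℕ : ∀ {m} → (Dot m → Dot m) → ℕ → Bool
headℕ f = onℕ (isHeadB f)

tails : ∀ {m} → Diagram m → List ℕ
tails {m} D = filterᵇ (tailℕ (match D)) (downFrom m)

heads : ∀ {m} → Diagram m → List ℕ
heads {m} D = filterᵇ (headℕ (match D)) (downFrom m)

Ilist≡ : ∀ {m} (D : Diagram m) → Ilist D ≡ map suc (tails D)
Ilist≡ {m} D = trans (map-∘ (filterᵇ (isTailB (match D)) (reverse (allFin m))))
  (cong (map suc) (trans (map-toℕ-filterᵇ (isTailB (match D)) (reverse (allFin m)))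
                         (cong (filterᵇ (tailℕ (match D))) (map-toℕ-reverse-allFin m))))

Jlist≡ : ∀ {m} (D : Diagram m) → Jlist D ≡ heads D
Jlist≡ {m} D = trans (map-toℕ-filterᵇ (isHeadB (match D)) (reverse (allFin m)))
                     (cong (filterᵇ (headℕ (match D))) (map-toℕ-reverse-allFin m))

length-Ilist : ∀ {m} (D : Diagram m) → length (Ilist D) ≡ size D
length-Ilist {m} D = trans (length-map _ (filterᵇ (isTailB (match D)) (reverse (allFin m))))
  (↭-length (filter-↭ (T? ∘ isTailB (match D)) (↭-reverse (allFin m))))

private
  T⇒≡true : ∀ {b} → T b → b ≡ true
  T⇒≡true {true} _ = refl

  ¬T⇒≡false : ∀ {b} → ¬ T b → b ≡ false
  ¬T⇒≡false {true}  ¬T = ⊥-elim (¬T tt)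
  ¬T⇒≡false {false} _  = refl

  ≡true⇒T : ∀ {b} → b ≡ true → T b
  ≡true⇒T refl = tt

module _ {m} (f : Dot m → Dot m) where

  tailℕ-at : ∀ {x k} → toℕ x ≡ k → tailℕ f k ≡ (toℕ x <ᵇ index (f (top x)))
  tailℕ-at {x} x≡k = trans (onℕ-at (isTailB f) x≡k) (by-partner (f (top x)) refl)
    where
    by-partner : ∀ d → f (top x) ≡ d → isTailB f x ≡ (toℕ x <ᵇ index d)
    by-partner d eq with f (top x) | eq
    ... | top _ | refl = refl
    ... | bot _ | refl = refl

  headℕ-at : ∀ {y k} → toℕ y ≡ k → headℕ f k ≡ (index (f (bot y)) <ᵇ toℕ y)
  headℕ-at {y} y≡k = trans (onℕ-at (isHeadB f) y≡k) (by-partner (f (bot y)) refl)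
    where
    by-partner : ∀ d → f (bot y) ≡ d → isHeadB f y ≡ (index d <ᵇ toℕ y)
    by-partner d eq with f (bot y) | eq
    ... | top _ | refl = refl
    ... | bot _ | refl = refl

  tailℕ-true : ∀ {x k} → toℕ x ≡ k → toℕ x < index (f (top x)) → tailℕ f k ≡ true
  tailℕ-true x≡k tail = trans (tailℕ-at x≡k) (T⇒≡true (<⇒<ᵇ tail))

  tailℕ-false : ∀ {x k} → toℕ x ≡ k → index (f (top x)) ≤ toℕ x → tailℕ f k ≡ false
  tailℕ-false x≡k ¬tail = trans (tailℕ-at x≡k) (¬T⇒≡false (λ t → <⇒≱ (<ᵇ⇒< _ _ t) ¬tail))

  tailℕ-true⁻ : ∀ x → tailℕ f (toℕ x) ≡ true → toℕ x < index (f (top x))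
  tailℕ-true⁻ x tail = <ᵇ⇒< _ _ (≡true⇒T (trans (sym (tailℕ-at refl)) tail))

  tailℕ-false⁻ : ∀ x → tailℕ f (toℕ x) ≡ false → index (f (top x)) ≤ toℕ x
  tailℕ-false⁻ x ¬tail = ≮⇒≥ (λ tail → subst T (trans (sym (tailℕ-at refl)) ¬tail) (<⇒<ᵇ tail))

  headℕ-true : ∀ {y k} → toℕ y ≡ k → index (f (bot y)) < toℕ y → headℕ f k ≡ true
  headℕ-true y≡k head = trans (headℕ-at y≡k) (T⇒≡true (<⇒<ᵇ head))

  headℕ-false : ∀ {y k} → toℕ y ≡ k → toℕ y ≤ index (f (bot y)) → headℕ f k ≡ false
  headℕ-false y≡k ¬head = trans (headℕ-at y≡k) (¬T⇒≡false (λ t → <⇒≱ (<ᵇ⇒< _ _ t) ¬head))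

tailℕ-agree : ∀ {m} (f g : Dot m → Dot m) {x k} → toℕ x ≡ k → g (top x) ≡ f (top x) → tailℕ g k ≡ tailℕ f k
tailℕ-agree f g {x} x≡k gx≡fx = trans (tailℕ-at g x≡k) (trans (cong (λ d → toℕ x <ᵇ index d) gx≡fx) (sym (tailℕ-at f x≡k)))

headℕ-agree : ∀ {m} (f g : Dot m → Dot m) {y k} → toℕ y ≡ k → g (bot y) ≡ f (bot y) → headℕ g k ≡ headℕ f k
headℕ-agree f g {y} y≡k gy≡fy = trans (headℕ-at g y≡k) (trans (cong (λ d → index d <ᵇ toℕ y) gy≡fy) (sym (headℕ-at f y≡k)))

-- The largest tail

LeftOf : ∀ {m} → ℕ → Dot m → Set
LeftOf c (top w) = toℕ w < c
LeftOf c (bot w) = toℕ w ≤ c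

LeftOf⇒index≤ : ∀ {m c} (d : Dot m) → LeftOf c d → index d ≤ c
LeftOf⇒index≤ (top w) w<c = <⇒≤ w<c
LeftOf⇒index≤ (bot w) w≤c = w≤c

-- Indices are 0-based: γ is the paper's top dot i₁ = c + 1.
module LargestTail {m} (D : Diagram m) (γ : Fin m)
                   (γ-tail : toℕ γ < index (match D (top γ)))
                   (no-tail-after : ∀ (x : Fin m) → toℕ γ < toℕ x → index (match D (top x)) ≤ toℕ x)
                   where

  private
    f = match D

  c : ℕ
  c = toℕ γ

  c+1<m : suc c < m
  c+1<m = <-≤-trans (s≤s γ-tail) (index<m (f (top γ)))

  γ₁ : Fin m
  γ₁ = fromℕ< c+1<m

  γ₁≡ : toℕ γ₁ ≡ suc c
  γ₁≡ = toℕ-fromℕ< c+1<m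

  γ₁-no-tail : index (f (top γ₁)) ≤ suc c
  γ₁-no-tail = subst (index (f (top γ₁)) ≤_) γ₁≡ (no-tail-after γ₁ (subst (c <_) (sym γ₁≡) (n<1+n c)))

  private
    c<γ₁ : pos (top γ) < pos (top γ₁)
    c<γ₁ = subst (c <_) (sym γ₁≡) (n<1+n c)

    γ₁-partner-≤ : ∀ {e} → f (top γ₁) ≡ e → index e ≤ suc c
    γ₁-partner-≤ eq = subst (λ e → index e ≤ suc c) eq γ₁-no-tail

    cap-inside : ∀ d e → c < index d → f (top γ₁) ≡ e → Between (top γ) d e → ⊥
    cap-inside d       (top w) _   eq (between< c<w _) =
      nofix D (top γ₁) (trans eq (cong top (toℕ-injective (≤-antisym (≤-trans (γ₁-partner-≤ eq) (≤-reflexive (sym γ₁≡)))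
                                                                      (subst (_≤ toℕ w) (sym γ₁≡) c<w)))))
    cap-inside (top z) (top w) c<z _  (between> z<w w<c) = <-asym (<-trans c<z z<w) w<c
    cap-inside (bot z) (top w) _   _  (between> z<w w<c) = <-asym z<w (<-trans w<c (top<bot γ z))
    cap-inside (top z) (bot w) _   _  (between< _ w<z) = <-asym w<z (top<bot z w)
    cap-inside (bot z) (bot w) c<z eq (between< _ w<z) = <⇒≱ (bot-pos-<⁻¹ z w w<z) (≤-trans (γ₁-partner-≤ eq) c<z)
    cap-inside d       (bot w) _   _  (between> _ w<c) = <-asym w<c (top<bot γ w)

  cap : f (top γ) ≡ top γ₁
  cap = by-cases (f (top γ)) refl
    where
    inside : ∀ {d} → f (top γ) ≡ d → top γ₁ ≢ d → Between (top γ) d (top γ₁) → ⊥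
    inside {d} eq γ₁≢d γ…d = cap-inside d (f (top γ₁)) (subst (λ e → c < index e) eq γ-tail) refl
      (subst (λ e → Between (top γ) e (f (top γ₁))) eq
        (nested D (top γ) (top γ₁) (pos-<⇒≢ c<γ₁ ∘ sym) (subst (top γ₁ ≢_) (sym eq) γ₁≢d) (subst (λ e → Between (top γ) e (top γ₁)) (sym eq) γ…d)))
    by-cases : ∀ d → f (top γ) ≡ d → d ≡ top γ₁
    by-cases (top z) eq with <-cmp (toℕ z) (suc c)
    ... | tri≈ _ z≡c+1 _ = cong top (toℕ-injective (trans z≡c+1 (sym γ₁≡)))
    ... | tri< z<c+1 _ _ = ⊥-elim (<⇒≱ (subst (λ e → c < index e) eq γ-tail) (≤-pred z<c+1))
    ... | tri> _ _ c+1<z = ⊥-elim (inside eq (pos-<⇒≢ γ₁<z) (between< c<γ₁ γ₁<z))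
      where
      γ₁<z : pos (top γ₁) < pos (top z)
      γ₁<z = subst (_< toℕ z) (sym γ₁≡) c+1<z
    by-cases (bot z) eq = ⊥-elim (inside eq top≢bot (between< c<γ₁ (top<bot γ₁ z)))

  private
    partner-≤ : ∀ {x e} → c < toℕ x → f (top x) ≡ e → index e ≤ toℕ x
    partner-≤ {x} c<x eq = subst (λ e → index e ≤ toℕ x) eq (no-tail-after x c<x)

    fix-top : ∀ {x w} → f (top x) ≡ top w → toℕ w ≡ toℕ x → ⊥
    fix-top {x} eq w≡x = nofix D (top x) (trans eq (cong top (toℕ-injective w≡x)))

  vertical-step : ∀ y x → c < toℕ y → toℕ x ≡ suc (toℕ y) → f (top y) ≡ bot y → f (top x) ≡ bot x
  vertical-step y x c<y x≡y+1 y↕ = by-cases (f (top x)) refl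
    (subst (λ d → Between (top y) d (f (top x))) y↕
      (nested D (top y) (top x) (pos-<⇒≢ y<x ∘ sym) (subst (top x ≢_) (sym y↕) top≢bot)
        (subst (λ d → Between (top y) d (top x)) (sym y↕) (between< y<x (top<bot x y)))))
    where
    y<x : toℕ y < toℕ x
    y<x = subst (toℕ y <_) (sym x≡y+1) (n<1+n (toℕ y))
    c<x = <-trans c<y y<x
    by-cases : ∀ e → f (top x) ≡ e → Between (top y) (bot y) e → f (top x) ≡ bot x
    by-cases (top w) eq (between< y<w _) =
      ⊥-elim (fix-top eq (≤-antisym (partner-≤ c<x eq) (subst (_≤ toℕ w) (sym x≡y+1) y<w)))
    by-cases (top w) eq (between> y<w _) = ⊥-elim (<-asym y<w (top<bot w y))
    by-cases (bot w) eq (between< _ w<y) =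
      trans eq (cong bot (toℕ-injective (≤-antisym (partner-≤ c<x eq) (subst (_≤ toℕ w) (sym x≡y+1) (bot-pos-<⁻¹ y w w<y)))))
    by-cases (bot w) eq (between> _ w<y) = ⊥-elim (<-asym w<y (top<bot y w))

  vertical-right : ∀ {x₀} → c < toℕ x₀ → f (top x₀) ≡ bot x₀ → ∀ x → toℕ x₀ ≤ toℕ x → f (top x) ≡ bot x
  vertical-right {x₀} c<x₀ x₀↕ x x₀≤x = by-distance (toℕ x ∸ toℕ x₀) x (sym (m+[n∸m]≡n x₀≤x))
    where
    by-distance : ∀ k x → toℕ x ≡ toℕ x₀ + k → f (top x) ≡ bot x
    by-distance zero    x x≡x₀ = subst (λ z → f (top z) ≡ bot z) (toℕ-injective (trans (sym (+-identityʳ _)) (sym x≡x₀))) x₀↕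
    by-distance (suc k) x x≡x₀+k+1 =
      vertical-step y x (≤-trans c<x₀ (subst (toℕ x₀ ≤_) (sym y≡) (m≤m+n _ k))) (trans x≡x₀+k+1 (trans (+-suc _ k) (cong suc (sym y≡))))
                    (by-distance k y y≡)
      where
      x₀+k<m : toℕ x₀ + k < m
      x₀+k<m = <-trans (subst (toℕ x₀ + k <_) (sym (trans x≡x₀+k+1 (+-suc _ k))) (n<1+n _)) (toℕ<n x)
      y = fromℕ< x₀+k<m
      y≡ : toℕ y ≡ toℕ x₀ + k
      y≡ = toℕ-fromℕ< x₀+k<m

  -- Right of the cap no top dot is joined to the bottom dot one column to its left: the next top dot
  -- would have to repeat that pattern further right, or be vertical, which traps bot x.
  no-slant : ∀ k x y → suc (toℕ x) + k ≡ m → c < toℕ y → toℕ x ≡ suc (toℕ y) → f (top x) ≢ bot y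
  no-slant zero    x y end c<y x≡y+1 slant =
    slant-not-last D slant x≡y+1 (λ w → ≤-pred (subst (toℕ w <_) (sym (trans (sym (+-identityʳ _)) end)) (toℕ<n w)))
  no-slant (suc k) x y end c<y x≡y+1 slant = by-partner (f (top x₁)) refl
      (slant-nested D slant x≡y+1 (top x₁) (pos-<⇒≢ x<x₁ ∘ sym) top≢bot (between< x<x₁ (top<bot x₁ y)))
    where
    x+1<m : suc (toℕ x) < m
    x+1<m = subst (suc (toℕ x) <_) end (m<m+n (suc (toℕ x)) (s≤s z≤n))
    x₁ = fromℕ< x+1<m
    x₁≡ : toℕ x₁ ≡ suc (toℕ x)
    x₁≡ = toℕ-fromℕ< x+1<m
    x<x₁ : toℕ x < toℕ x₁
    x<x₁ = subst (toℕ x <_) (sym x₁≡) (n<1+n _)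
    c<x₁ = <-trans (<-trans c<y (subst (toℕ y <_) (sym x≡y+1) (n<1+n _))) x<x₁
    by-partner : ∀ d → f (top x₁) ≡ d → Between (top x) (bot y) d → ⊥
    by-partner (top w) eq (between< x<w _) = fix-top eq (≤-antisym (partner-≤ c<x₁ eq) (subst (_≤ toℕ w) (sym x₁≡) x<w))
    by-partner (top w) eq (between> y<w _) = <-asym y<w (top<bot w y)
    by-partner (bot w) eq (between> _ w<x) = <-asym w<x (top<bot x w)
    by-partner (bot w) eq (between< _ w<y) with <-cmp (toℕ w) (toℕ x₁)
    ... | tri< w<x₁ _ _ =
      no-slant k x₁ w (trans (cong (λ i → suc i + k) x₁≡) (trans (sym (+-suc (suc (toℕ x)) k)) end)) (<-trans c<y y<w)
               (trans x₁≡ (cong suc (sym w≡x))) eq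
      where
      y<w = bot-pos-<⁻¹ y w w<y
      w≡x : toℕ w ≡ toℕ x
      w≡x = ≤-antisym (≤-pred (subst (toℕ w <_) x₁≡ w<x₁)) (subst (_≤ toℕ w) (sym x≡y+1) y<w)
    ... | tri≈ _ w≡x₁ _ = slant-not-beside-vertical D slant x≡y+1 x₁≡ (trans eq (cong bot (toℕ-injective w≡x₁)))
    ... | tri> _ _ x₁<w = <⇒≱ x₁<w (partner-≤ c<x₁ eq)

  data Shape : Set where
    next-joins-left     : (γ₂ : Fin m) → toℕ γ₂ ≡ suc (suc c) → LeftOf c (f (top γ₂)) → Shape
    all-vertical : (∀ x → suc c < toℕ x → f (top x) ≡ bot x) → Shape

  shape : Shape
  shape with suc (suc c) <? m
  ... | no c+2≮m  = all-vertical (λ x c+1<x → ⊥-elim (c+2≮m (≤-<-trans c+1<x (toℕ<n x))))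
  ... | yes c+2<m = by-cases (f (top γ₂)) refl
    where
    γ₂ = fromℕ< c+2<m
    γ₂≡ : toℕ γ₂ ≡ suc (suc c)
    γ₂≡ = toℕ-fromℕ< c+2<m
    c<γ₂ : c < toℕ γ₂
    c<γ₂ = subst (c <_) (sym γ₂≡) (m<n⇒m<1+n (n<1+n c))
    γ₁≢γ₂ : top γ₁ ≢ top γ₂
    γ₁≢γ₂ e = 1+n≢n (trans (sym γ₂≡) (trans (cong toℕ (top-injective (sym e))) γ₁≡))
    by-cases : ∀ d → f (top γ₂) ≡ d → Shape
    by-cases (top w) eq with <-cmp (toℕ w) c | <-cmp (toℕ w) (suc c)
    ... | tri< w<c _ _ | _ = next-joins-left γ₂ γ₂≡ (subst (LeftOf c) (sym eq) w<c)
    ... | tri≈ _ w≡c _ | _ = ⊥-elim (γ₁≢γ₂ (trans (sym cap) (trans (cong (f ∘ top) (toℕ-injective (sym w≡c))) (match-flip D eq))))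
    ... | tri> _ _ c<w | tri< w<c+1 _ _ = ⊥-elim (<⇒≱ c<w (≤-pred w<c+1))
    ... | tri> _ _ _   | tri≈ _ w≡c+1 _ =
      ⊥-elim (pos-<⇒≢ c<γ₂ (trans (sym (match-flip D cap)) (trans (cong (f ∘ top) (toℕ-injective (trans γ₁≡ (sym w≡c+1)))) (match-flip D eq))))
    ... | tri> _ _ _   | tri> _ _ c+1<w =
      ⊥-elim (fix-top eq (≤-antisym (partner-≤ c<γ₂ eq) (subst (_≤ toℕ w) (sym γ₂≡) c+1<w)))
    by-cases (bot w) eq with <-cmp (toℕ w) (suc c)
    ... | tri< w<c+1 _ _ = next-joins-left γ₂ γ₂≡ (subst (LeftOf c) (sym eq) (≤-pred w<c+1))
    ... | tri≈ _ w≡c+1 _ =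
      ⊥-elim (no-slant (m ∸ suc (toℕ γ₂)) γ₂ w (m+[n∸m]≡n (toℕ<n γ₂)) (subst (c <_) (sym w≡c+1) (n<1+n c)) (trans γ₂≡ (cong suc (sym w≡c+1))) eq)
    ... | tri> _ _ c+1<w = all-vertical (λ x c+1<x → vertical-right c<γ₂ γ₂↕ x (subst (_≤ toℕ x) (sym γ₂≡) c+1<x))
      where
      γ₂↕ : f (top γ₂) ≡ bot γ₂
      γ₂↕ = trans eq (cong bot (toℕ-injective (≤-antisym (partner-≤ c<γ₂ eq) (subst (_≤ toℕ w) (sym γ₂≡) c+1<w))))

module Opening {k : ℕ} (D : Diagram (suc (suc k))) (γ : Fin (suc (suc k)))
               (γ-tail : toℕ γ < index (match D (top γ)))
               (no-tail-after : ∀ (x : Fin (suc (suc k))) → toℕ γ < toℕ x → index (match D (top x)) ≤ toℕ x)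
               where

  open LargestTail D γ γ-tail no-tail-after public

  private
    m : ℕ
    m = suc (suc k)
    f : Dot m → Dot m
    f = match D

  tails-at-largest : tails D ≡ c ∷ filterᵇ (tailℕ f) (downFrom c)
  tails-at-largest = trans (filter-downFrom-skip (tailℕ f) c+1<m⁻ none-after)
                           (filterᵇ-accept (tailℕ f) {c} {downFrom c} (tailℕ-true f refl γ-tail))
    where
    c+1<m⁻ : suc c ≤ m
    c+1<m⁻ = <⇒≤ c+1<m
    none-after : ∀ j → suc c ≤ j → j < m → tailℕ f j ≡ false
    none-after j c<j j<m = every-index (λ i → c < i → tailℕ f i ≡ false) (λ x c<x → tailℕ-false f refl (no-tail-after x c<x)) j j<m c<j

  module OpenAlong (Q : Dot m) (β<Q : pos (top γ₁) < pos Q) (P-left : LeftOf c (f Q))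
                (Q<left-bots : ∀ (w : Fin m) → toℕ w ≤ c → pos Q < pos (bot w))
                (β…Q-closed : ∀ (x : Dot m) → pos (top γ₁) < pos x → pos x < pos Q → pos (top γ₁) < pos (f x) × pos (f x) < pos Q)
                where

    P-outside : pos (f Q) < pos (top γ) ⊎ pos Q < pos (f Q)
    P-outside = outside (f Q) P-left
      where
      outside : ∀ d → LeftOf c d → pos d < c ⊎ pos Q < pos d
      outside (top w) w<c = inj₁ w<c
      outside (bot w) w≤c = inj₂ (Q<left-bots w w≤c)

    open OpenCap D (top γ) (top γ₁) Q cap γ₁≡ β<Q P-outside β…Q-closed public

    D′ : Diagram m
    D′ = opened

    private
      E′ : Dot m → Dot m
      E′ = E (suc c)

      γ-away-top : ∀ s → s ≢ γ → s ≢ γ₁ → E′ (top s) ≡ bot s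
      γ-away-top = E-top-away refl γ₁≡

      γ-away-bot : ∀ s → s ≢ γ → s ≢ γ₁ → E′ (bot s) ≡ top s
      γ-away-bot = E-bot-away refl γ₁≡

      γ₁-away-top : ∀ s → s ≢ γ₁ → s ≢ γ → E′ (top s) ≡ bot s
      γ₁-away-top s s≢γ₁ s≢γ = γ-away-top s s≢γ s≢γ₁

      γ₁-away-bot : ∀ s → s ≢ γ₁ → s ≢ γ → E′ (bot s) ≡ top s
      γ₁-away-bot s s≢γ₁ s≢γ = γ-away-bot s s≢γ s≢γ₁

    module FromLower = ConcatCap E′ D′ γ γ₁ (E-top-lower refl γ₁≡) (E-bot-lower refl γ₁≡) γ-away-top γ-away-bot
    module FromUpper = ConcatCap E′ D′ γ₁ γ (E-top-upper refl γ₁≡) (E-bot-upper refl γ₁≡) γ₁-away-top γ₁-away-bot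

    c<index-Q : c < index Q
    c<index-Q = after-cap Q β<Q (Q<left-bots γ ≤-refl)
      where
      after-cap : ∀ d → pos (top γ₁) < pos d → pos d < pos (bot γ) → c < index d
      after-cap (top a) c+1<a _     = <-trans (n<1+n c) (subst (_< toℕ a) γ₁≡ c+1<a)
      after-cap (bot a) _     a<γ   = bot-pos-<⁻¹ γ a a<γ

    private
      <c⇒≢γ : ∀ {w} → toℕ w < c → w ≢ γ
      <c⇒≢γ w<c w≡γ = <-irrefl (cong toℕ w≡γ) w<c

      <c⇒≢γ₁ : ∀ {w} → toℕ w < c → w ≢ γ₁
      <c⇒≢γ₁ w<c w≡γ₁ = <-irrefl (trans (cong toℕ w≡γ₁) γ₁≡) (m<n⇒m<1+n w<c)

      avoids-cap : ∀ {x} → Old x → ∀ s → g x ≡ top s → s ≢ γ × s ≢ γ₁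
      avoids-cap (_ , _ , x≢P , x≢Q) s gx≡s =
        (λ { refl → x≢P (trans (sym (match-flip D′ gx≡s)) g-α) }) ,
        (λ { refl → x≢Q (trans (sym (match-flip D′ gx≡s)) g-β) })

      at-P : ∀ d → P ≡ d → LeftOf c d → f d ≡ concatD E′ g d
      at-P (top w) P≡d w<c = begin
        f (top w)                  ≡⟨ trans (cong f (sym P≡d)) P↔Q ⟩
        Q                          ≡⟨ sym g-β ⟩
        g (top γ₁)                 ≡⟨ sym (FromLower.bounce-top w (<c⇒≢γ w<c) (<c⇒≢γ₁ w<c) (trans (cong g (sym P≡d)) g-P)) ⟩
        concatD E′ g (top w)       ∎
        where open ≡-Reasoning
      at-P (bot w) P≡d _ = trans (trans (cong f (sym P≡d)) P↔Q) (sym (trans (FromLower.bounce-bot w (trans (cong g (sym P≡d)) g-P)) g-β))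

      at-Q : ∀ d → Q ≡ d → pos (top γ₁) < pos d → f d ≡ concatD E′ g d
      at-Q (top a) Q≡d γ₁<a = begin
        f (top a)                  ≡⟨ cong f (sym Q≡d) ⟩
        P                          ≡⟨ sym g-α ⟩
        g (top γ)                  ≡⟨ sym (FromUpper.bounce-top a a≢γ₁ a≢γ (trans (cong g (sym Q≡d)) g-Q)) ⟩
        concatD E′ g (top a)       ∎
        where
        open ≡-Reasoning
        a≢γ : a ≢ γ
        a≢γ a≡γ = <-asym (n<1+n c) (subst (suc c <_) (cong toℕ a≡γ) (subst (_< toℕ a) γ₁≡ γ₁<a))
        a≢γ₁ : a ≢ γ₁
        a≢γ₁ a≡γ₁ = <-irrefl (cong toℕ (sym a≡γ₁)) γ₁<a
      at-Q (bot a) Q≡d _ = trans (cong f (sym Q≡d)) (sym (trans (FromUpper.bounce-bot a (trans (cong g (sym Q≡d)) g-Q)) g-α))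

      at-old : ∀ x → Old x → f x ≡ concatD E′ g x
      at-old (top a) old@(a≢α , a≢β , _ , _) =
        trans (sym (g-old old)) (sym (FromLower.through-top a (a≢α ∘ cong top) (a≢β ∘ cong top) (avoids-cap old)))
      at-old (bot a) old = trans (sym (g-old old)) (sym (FromLower.through-bot a (avoids-cap old)))

    composition : ∀ x → f x ≡ concatD (E (suc c)) (match D′) x
    composition x with role x
    ... | inj₁ (is-α refl) = trans cap (sym FromLower.at-cap)
    ... | inj₁ (is-β refl) = trans (match-flip D cap) (sym FromUpper.at-cap)
    ... | inj₁ (is-P refl) = at-P P refl P-left
    ... | inj₁ (is-Q refl) = at-Q Q refl β<Q
    ... | inj₂ old         = at-old x old

    private
      P≤c : index P ≤ c
      P≤c = LeftOf⇒index≤ P P-left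

      ≤c+1⇒≢Q : ∀ {x} → pos x ≤ suc c → x ≢ Q
      ≤c+1⇒≢Q {x} x≤c+1 x≡Q = <⇒≱ β<Q (subst (pos Q ≤_) (sym γ₁≡) (subst (λ d → pos d ≤ suc c) x≡Q x≤c+1))

    tail-at-c : tailℕ g c ≡ false
    tail-at-c = tailℕ-false g {x = γ} refl (subst (λ d → index d ≤ c) (sym g-α) P≤c)

    tails-below : ∀ j → j < c → tailℕ g j ≡ tailℕ f j
    tails-below j j<c = by-cases (top x ≟ᴰ P)
      where
      j<m : j < m
      j<m = <-trans j<c (<-trans (n<1+n c) c+1<m)
      x = fromℕ< j<m
      x≡j : toℕ x ≡ j
      x≡j = toℕ-fromℕ< j<m
      x<c : toℕ x < c
      x<c = subst (_< c) (sym x≡j) j<c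
      by-cases : Dec (top x ≡ P) → tailℕ g j ≡ tailℕ f j
      by-cases (yes x≡P) = trans (tailℕ-true g x≡j (subst (λ d → toℕ x < index d) (sym (trans (cong g x≡P) g-P)) x<c))
                           (sym (tailℕ-true f x≡j (subst (λ d → toℕ x < index d) (sym (trans (cong f x≡P) P↔Q)) (<-trans x<c c<index-Q))))
      by-cases (no x≢P)  = tailℕ-agree f g x≡j (g-old (<c⇒≢γ x<c ∘ top-injective , <c⇒≢γ₁ x<c ∘ top-injective , x≢P , ≤c+1⇒≢Q (m≤n⇒m≤1+n (<⇒≤ x<c))))

    tail-after : ∀ x → top x ≢ Q → suc c < toℕ x → tailℕ g (toℕ x) ≡ false
    tail-after x x≢Q c+1<x = trans (tailℕ-agree f g refl (g-old old)) (tailℕ-false f refl (no-tail-after x c<x))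
      where
      c<x = <-trans (n<1+n c) c+1<x
      old : Old (top x)
      old = (λ x≡α → <-irrefl (sym (cong toℕ (top-injective x≡α))) c<x) ,
            (λ x≡β → <-irrefl (sym (trans (cong toℕ (top-injective x≡β)) γ₁≡)) c+1<x) ,
            (λ x≡P → <⇒≱ c<x (subst (λ d → index d ≤ c) (sym x≡P) P≤c)) ,
            x≢Q

    heads-agree : ∀ y → bot y ≢ Q → headℕ g (toℕ y) ≡ headℕ f (toℕ y)
    heads-agree y y≢Q with bot y ≟ᴰ P
    ... | yes y≡P = trans (headℕ-false g refl (subst (λ d → toℕ y ≤ index d) (sym (trans (cong g y≡P) g-P)) y≤c))
                          (sym (headℕ-false f refl (subst (λ d → toℕ y ≤ index d) (sym (trans (cong f y≡P) P↔Q)) (<⇒≤ (≤-<-trans y≤c c<index-Q)))))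
      where
      y≤c : toℕ y ≤ c
      y≤c = subst (λ d → index d ≤ c) (sym y≡P) P≤c
    ... | no y≢P  = headℕ-agree f g refl (g-old (top≢bot ∘ sym , top≢bot ∘ sym , y≢P , y≢Q))

  module NextJoinsLeft (γ₂ : Fin m) (γ₂≡ : toℕ γ₂ ≡ suc (suc c)) (P-left : LeftOf c (f (top γ₂))) where

    private
      γ₁<γ₂ : pos (top γ₁) < pos (top γ₂)
      γ₁<γ₂ = subst₂ _<_ (sym γ₁≡) (sym γ₂≡) (n<1+n (suc c))

      nothing-between : ∀ x → pos (top γ₁) < pos x → pos x < pos (top γ₂) → pos (top γ₁) < pos (f x) × pos (f x) < pos (top γ₂)
      nothing-between x γ₁<x x<γ₂ = ⊥-elim (<⇒≱ (subst (_< pos x) γ₁≡ γ₁<x) (≤-pred (subst (pos x <_) γ₂≡ x<γ₂)))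

      before-bots : ∀ w → toℕ w ≤ c → pos (top γ₂) < pos (bot w)
      before-bots w _ = top<bot γ₂ w

    open OpenAlong (top γ₂) γ₁<γ₂ P-left before-bots nothing-between public

    tails-opened : tails D′ ≡ suc c ∷ filterᵇ (tailℕ f) (downFrom c)
    tails-opened = begin
      filterᵇ (tailℕ g) (downFrom m)                        ≡⟨ filter-downFrom-skip (tailℕ g) (subst (_≤ m) γ₂≡ (<⇒≤ (toℕ<n γ₂))) no-tail-from-γ₂ ⟩
      filterᵇ (tailℕ g) (downFrom (suc (suc c)))            ≡⟨ filterᵇ-accept (tailℕ g) {suc c} {downFrom (suc c)} (tailℕ-true g γ₁≡ γ₁-tail) ⟩
      suc c ∷ filterᵇ (tailℕ g) (downFrom (suc c))          ≡⟨ cong (suc c ∷_) (filterᵇ-reject (tailℕ g) {c} {downFrom c} tail-at-c) ⟩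
      suc c ∷ filterᵇ (tailℕ g) (downFrom c)                ≡⟨ cong (suc c ∷_) (filter-downFrom-cong (tailℕ g) (tailℕ f) c tails-below) ⟩
      suc c ∷ filterᵇ (tailℕ f) (downFrom c)                ∎
      where
      open ≡-Reasoning
      γ₁-tail : toℕ γ₁ < index (g (top γ₁))
      γ₁-tail = subst (λ d → toℕ γ₁ < index d) (sym g-β) γ₁<γ₂
      no-tail-from-γ₂ : ∀ j → suc (suc c) ≤ j → j < m → tailℕ g j ≡ false
      no-tail-from-γ₂ j c+2≤j j<m with m≤n⇒m<n∨m≡n c+2≤j
      ... | inj₂ refl   = tailℕ-false g γ₂≡ (subst (λ d → index d ≤ toℕ γ₂) (sym g-Q) (<⇒≤ γ₁<γ₂))
      ... | inj₁ c+2<j  = subst (λ i → tailℕ g i ≡ false) (toℕ-fromℕ< j<m)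
        (tail-after x (λ x≡γ₂ → <-irrefl (trans (sym γ₂≡) (sym (cong toℕ (top-injective x≡γ₂)))) (subst (suc (suc c) <_) (sym (toℕ-fromℕ< j<m)) c+2<j))
                      (subst (suc c <_) (sym (toℕ-fromℕ< j<m)) (<-trans (n<1+n (suc c)) c+2<j)))
        where x = fromℕ< j<m

    heads-opened : heads D′ ≡ heads D
    heads-opened = filter-downFrom-cong (headℕ g) (headℕ f) m (λ j j<m →
      subst (λ i → headℕ g i ≡ headℕ f i) (toℕ-fromℕ< j<m) (heads-agree (fromℕ< j<m) (top≢bot ∘ sym)))

  module AllVertical (vertical : ∀ (x : Fin m) → suc c < toℕ x → f (top x) ≡ bot x) where

    private
      vertical⁻¹ : ∀ x → suc c < toℕ x → f (bot x) ≡ top x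
      vertical⁻¹ x c+1<x = match-flip D (vertical x c+1<x)

      γ₁<⇒c+1< : ∀ {w : Fin m} → toℕ γ₁ < toℕ w → suc c < toℕ w
      γ₁<⇒c+1< {w} = subst (_< toℕ w) γ₁≡

      P-left : LeftOf c (f (bot γ₁))
      P-left = by-cases (f (bot γ₁)) refl
        where
        by-cases : ∀ d → f (bot γ₁) ≡ d → LeftOf c d
        by-cases (top w) eq with <-cmp (toℕ w) c | <-cmp (toℕ w) (suc c)
        ... | tri< w<c _ _ | _ = w<c
        ... | tri≈ _ w≡c _ | _ = ⊥-elim (top≢bot (trans (sym cap) (trans (cong (f ∘ top) (toℕ-injective (sym w≡c))) (match-flip D eq))))
        ... | tri> _ _ _   | tri≈ _ w≡c+1 _ =
          ⊥-elim (top≢bot (trans (sym (match-flip D cap)) (trans (cong (f ∘ top) (toℕ-injective (trans γ₁≡ (sym w≡c+1)))) (match-flip D eq))))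
        ... | tri> _ _ c<w | tri< w<c+1 _ _ = ⊥-elim (<⇒≱ c<w (≤-pred w<c+1))
        ... | tri> _ _ _   | tri> _ _ c+1<w =
          ⊥-elim (<-irrefl (trans (sym γ₁≡) (cong toℕ (bot-injective (trans (sym (match-flip D eq)) (vertical w c+1<w))))) c+1<w)
        by-cases (bot w) eq with <-cmp (toℕ w) (suc c)
        ... | tri< w<c+1 _ _ = ≤-pred w<c+1
        ... | tri≈ _ w≡c+1 _ = ⊥-elim (nofix D (bot γ₁) (trans eq (cong bot (toℕ-injective (trans w≡c+1 (sym γ₁≡))))))
        ... | tri> _ _ c+1<w = ⊥-elim (top≢bot (trans (sym (vertical⁻¹ w c+1<w)) (match-flip D eq)))

      before-right-bots : ∀ w → toℕ w ≤ c → pos (bot γ₁) < pos (bot w)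
      before-right-bots w w≤c = bot-pos-< w γ₁ (subst (toℕ w <_) (sym γ₁≡) (s≤s w≤c))

      inside-closed : ∀ x → pos (top γ₁) < pos x → pos x < pos (bot γ₁) → pos (top γ₁) < pos (f x) × pos (f x) < pos (bot γ₁)
      inside-closed (top w) γ₁<w _ rewrite vertical w (γ₁<⇒c+1< γ₁<w) = top<bot γ₁ w , bot-pos-< γ₁ w γ₁<w
      inside-closed (bot w) _ w<γ₁ rewrite vertical⁻¹ w (γ₁<⇒c+1< (bot-pos-<⁻¹ γ₁ w w<γ₁)) =
        bot-pos-<⁻¹ γ₁ w w<γ₁ , top<bot w γ₁

    open OpenAlong (bot γ₁) (top<bot γ₁ γ₁) P-left before-right-bots inside-closed public

    private
      no-head-from-γ₁ : ∀ j → suc c ≤ j → j < m → headℕ g j ≡ false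
      no-head-from-γ₁ j c+1≤j j<m with m≤n⇒m<n∨m≡n c+1≤j
      ... | inj₂ refl  = headℕ-false g γ₁≡ (subst (λ d → toℕ γ₁ ≤ index d) (sym g-Q) ≤-refl)
      ... | inj₁ c+1<j = subst (λ i → headℕ g i ≡ false) (toℕ-fromℕ< j<m)
        (trans (heads-agree x (λ x≡γ₁ → <-irrefl (trans (sym γ₁≡) (cong toℕ (sym (bot-injective x≡γ₁)))) x>c+1))
               (headℕ-false f refl (subst (λ d → toℕ x ≤ index d) (sym (vertical⁻¹ x x>c+1)) ≤-refl)))
        where
        x = fromℕ< j<m
        x>c+1 : suc c < toℕ x
        x>c+1 = subst (suc c <_) (sym (toℕ-fromℕ< j<m)) c+1<j

    heads-opened-below : All (_< suc c) (heads D′)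
    heads-opened-below = subst (All (_< suc c)) (sym (filter-downFrom-skip (headℕ g) (<⇒≤ c+1<m) no-head-from-γ₁))
                               (filter-downFrom-below (headℕ g) (suc c))

    tails-opened : tails D′ ≡ filterᵇ (tailℕ f) (downFrom c)
    tails-opened = trans (filter-downFrom-skip (tailℕ g) (<⇒≤ (<-trans (n<1+n c) c+1<m)) no-tail-from-γ)
                         (filter-downFrom-cong (tailℕ g) (tailℕ f) c tails-below)
      where
      no-tail-from-γ : ∀ j → c ≤ j → j < m → tailℕ g j ≡ false
      no-tail-from-γ j c≤j j<m with m≤n⇒m<n∨m≡n c≤j
      ... | inj₂ refl = tail-at-c
      ... | inj₁ c<j with m≤n⇒m<n∨m≡n c<j
      ...   | inj₂ refl  = tailℕ-false g γ₁≡ (subst (λ d → index d ≤ toℕ γ₁) (sym g-β) ≤-refl)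
      ...   | inj₁ c+1<j = subst (λ i → tailℕ g i ≡ false) (toℕ-fromℕ< j<m)
                             (tail-after (fromℕ< j<m) top≢bot (subst (suc c <_) (sym (toℕ-fromℕ< j<m)) c+1<j))

    heads-opened : heads D ≡ suc c ∷ heads D′
    heads-opened = begin
      filterᵇ (headℕ f) (downFrom m)                       ≡⟨ filter-downFrom-skip (headℕ f) c+1<m no-head-after-γ₁ ⟩
      filterᵇ (headℕ f) (downFrom (suc (suc c)))           ≡⟨ filterᵇ-accept (headℕ f) {suc c} {downFrom (suc c)} (headℕ-true f γ₁≡ P<γ₁) ⟩
      suc c ∷ filterᵇ (headℕ f) (downFrom (suc c))         ≡⟨ cong (suc c ∷_) (sym (filter-downFrom-cong (headℕ g) (headℕ f) (suc c) heads-below)) ⟩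
      suc c ∷ filterᵇ (headℕ g) (downFrom (suc c))         ≡⟨ cong (suc c ∷_) (sym (filter-downFrom-skip (headℕ g) (<⇒≤ c+1<m) no-head-from-γ₁)) ⟩
      suc c ∷ filterᵇ (headℕ g) (downFrom m)               ∎
      where
      open ≡-Reasoning
      P<γ₁ : index (f (bot γ₁)) < toℕ γ₁
      P<γ₁ = subst (index (f (bot γ₁)) <_) (sym γ₁≡) (s≤s (LeftOf⇒index≤ (f (bot γ₁)) P-left))
      no-head-after-γ₁ : ∀ j → suc (suc c) ≤ j → j < m → headℕ f j ≡ false
      no-head-after-γ₁ j c+1<j j<m = headℕ-false f (toℕ-fromℕ< j<m)
        (subst (λ d → toℕ (fromℕ< j<m) ≤ index d) (sym (vertical⁻¹ (fromℕ< j<m) (subst (suc c <_) (sym (toℕ-fromℕ< j<m)) c+1<j))) ≤-refl)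
      heads-below : ∀ j → j < suc c → headℕ g j ≡ headℕ f j
      heads-below j j<c+1 = subst (λ i → headℕ g i ≡ headℕ f i) (toℕ-fromℕ< j<m)
        (heads-agree (fromℕ< j<m) (λ y≡γ₁ → <-irrefl (trans (sym (toℕ-fromℕ< j<m)) (trans (cong toℕ (bot-injective y≡γ₁)) γ₁≡)) j<c+1))
        where
        j<m = <-trans j<c+1 c+1<m

-- Decomposition

Decomposition : ∀ n → Diagram (suc n) → Set
Decomposition n D = Canonical n (map suc (tails D)) (heads D) × (∀ x → match D x ≡ 𝒟 (canonWord (map suc (tails D)) (heads D)) x)

-- Decreases when the largest tail moves one column right (first case) or a tail and a head disappear.
weight : ∀ {m} → Diagram m → ℕ
weight {m} D = sum (map (m ∸_) (tails D)) + length (heads D)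

no-tails⇒identity : ∀ {m} (D : Diagram m) → (∀ x → index (match D (top x)) ≤ toℕ x) → ∀ x → match D (top x) ≡ bot x
no-tails⇒identity {m} D no-tails x = left-to-right (suc (toℕ x)) x ≤-refl
  where
  f = match D
  left-to-right : ∀ d x → toℕ x < d → f (top x) ≡ bot x
  left-to-right (suc d) x x<d+1 = by-cases (f (top x)) refl
    where
    before : ∀ {w} → toℕ w < toℕ x → f (top w) ≡ bot w
    before w<x = left-to-right d _ (<-≤-trans w<x (≤-pred x<d+1))
    by-cases : ∀ e → f (top x) ≡ e → f (top x) ≡ bot x
    by-cases (top w) eq with m≤n⇒m<n∨m≡n (subst (λ e → index e ≤ toℕ x) eq (no-tails x))
    ... | inj₁ w<x = ⊥-elim (top≢bot (trans (sym (match-flip D eq)) (before w<x)))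
    ... | inj₂ w≡x = ⊥-elim (nofix D (top x) (trans eq (cong top (toℕ-injective w≡x))))
    by-cases (bot w) eq with m≤n⇒m<n∨m≡n (subst (λ e → index e ≤ toℕ x) eq (no-tails x))
    ... | inj₁ w<x = ⊥-elim (<-irrefl (cong toℕ (top-injective (match-injective D (trans (before w<x) (sym eq))))) w<x)
    ... | inj₂ w≡x = trans eq (cong bot (toℕ-injective w≡x))

identity-decomposition : ∀ {n} (D : Diagram (suc n)) → (∀ x → index (match D (top x)) ≤ toℕ x) → Decomposition n D
identity-decomposition {n} D no-tails =
  subst₂ (λ I J → Canonical n (map suc I) J × (∀ x → match D x ≡ 𝒟 (canonWord (map suc I) J) x)) (sym no-tail-list) (sym no-head-list)
         ([] , identity)
  where
  f = match D
  vertical = no-tails⇒identity D no-tails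
  no-tail-list : tails D ≡ []
  no-tail-list = filter-downFrom-skip (tailℕ f) z≤n
    (λ j _ → every-index (λ i → tailℕ f i ≡ false) (λ x → tailℕ-false f refl (no-tails x)) j)
  no-head-list : heads D ≡ []
  no-head-list = filter-downFrom-skip (headℕ f) z≤n
    (λ j _ → every-index (λ i → headℕ f i ≡ false) (λ y → headℕ-false f refl (subst (λ d → toℕ y ≤ index d) (sym (match-flip D (vertical y))) ≤-refl)) j)
  identity : ∀ x → f x ≡ 𝒟 [] x
  identity (top x) = vertical x
  identity (bot x) = match-flip D (vertical x)

largest-tail : ∀ {m} (D : Diagram m) →
  (∀ x → index (match D (top x)) ≤ toℕ x) ⊎
  Σ (Fin m) (λ γ → toℕ γ < index (match D (top γ)) × (∀ x → toℕ γ < toℕ x → index (match D (top x)) ≤ toℕ x))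
largest-tail {m} D with largest-true (tailℕ (match D)) m
... | inj₁ none = inj₁ (λ x → tailℕ-false⁻ (match D) x (none (toℕ x) (toℕ<n x)))
... | inj₂ (c , c<m , c-tail , none-above) =
  inj₂ (γ , tailℕ-true⁻ (match D) γ (subst (λ i → tailℕ (match D) i ≡ true) (sym γ≡c) c-tail) ,
        λ x γ<x → tailℕ-false⁻ (match D) x (none-above (toℕ x) (subst (_< toℕ x) γ≡c γ<x) (toℕ<n x)))
  where
  γ = fromℕ< c<m
  γ≡c : toℕ γ ≡ c
  γ≡c = toℕ-fromℕ< c<m

composed-decomposition : ∀ {n a} (D D′ : Diagram (suc n)) → (∀ x → match D x ≡ concatD (E a) (match D′) x) →
  (Canonical n (map suc (tails D′)) (heads D′) →
     Canonical n (map suc (tails D)) (heads D) × canonWord (map suc (tails D)) (heads D) ≡ a ∷ canonWord (map suc (tails D′)) (heads D′)) →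
  Decomposition n D′ → Decomposition n D
composed-decomposition {a = a} D D′ D≗E∗D′ extend (canonical′ , D′≗) = proj₁ (extend canonical′) , λ x → begin
  match D x                         ≡⟨ D≗E∗D′ x ⟩
  concatD (E a) (match D′) x        ≡⟨ concatD-cong (E a) (match D′) _ D′≗ x ⟩
  𝒟 (a ∷ canonWord (map suc (tails D′)) (heads D′)) x   ≡⟨ cong (λ w → 𝒟 w x) (sym (proj₂ (extend canonical′))) ⟩
  𝒟 (canonWord (map suc (tails D)) (heads D)) x         ∎
  where open ≡-Reasoning

-- Taking the list equations as hypotheses lets them be matched with refl instead of rewriting tails D and heads D.
grow-first-block : ∀ {n c rest T J T′ J′} → T ≡ c ∷ rest → T′ ≡ suc c ∷ rest → J′ ≡ J → All (_< suc c) (map suc rest) →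
  Canonical n (map suc T′) J′ → Canonical n (map suc T) J × canonWord (map suc T) J ≡ suc c ∷ canonWord (map suc T′) J′
grow-first-block refl refl refl rest<c+1 canonical′ = grow-block canonical′ (s≤s z≤n) rest<c+1

add-first-block : ∀ {n c rest T J T′ J′} → T ≡ c ∷ rest → T′ ≡ rest → J ≡ suc c ∷ J′ → suc c ≤ n →
  All (_< suc c) (map suc rest) → All (_< suc c) J′ →
  Canonical n (map suc T′) J′ → Canonical n (map suc T) J × canonWord (map suc T) J ≡ suc c ∷ canonWord (map suc T′) J′
add-first-block refl refl refl c+1≤n rest<c+1 J′<c+1 canonical′ = new-block canonical′ (s≤s z≤n) c+1≤n rest<c+1 J′<c+1

weight-grow : ∀ {M c rest T T′ L L′} → T ≡ c ∷ rest → T′ ≡ suc c ∷ rest → L′ ≡ L → c < M →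
  sum (map (M ∸_) T′) + L′ < sum (map (M ∸_) T) + L
weight-grow {M} {c} {rest} {L = L} refl refl refl c<M = +-monoˡ-< L (+-monoˡ-< (sum (map (M ∸_) rest)) (∸-monoʳ-< (n<1+n c) c<M))

weight-add : ∀ {M c rest T T′ L L′} → T ≡ c ∷ rest → T′ ≡ rest → L ≡ suc L′ →
  sum (map (M ∸_) T′) + L′ < sum (map (M ∸_) T) + L
weight-add {M} {c} {rest} {L′ = L′} refl refl refl = +-mono-≤-< (m≤n+m (sum (map (M ∸_) rest)) (M ∸ c)) (n<1+n L′)

peel-largest-tail : ∀ {k} (D : Diagram (suc (suc k))) (γ : Fin (suc (suc k))) →
  toℕ γ < index (match D (top γ)) → (∀ x → toℕ γ < toℕ x → index (match D (top x)) ≤ toℕ x) →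
  (∀ D′ → weight D′ < weight D → Decomposition (suc k) D′) → Decomposition (suc k) D
peel-largest-tail {k} D γ γ-tail no-tail-after decompose-lighter = by-shape shape
  where
  open Opening D γ γ-tail no-tail-after
  I<c+1 : All (_< suc c) (map suc (filterᵇ (tailℕ (match D)) (downFrom c)))
  I<c+1 = map⁺ (All.map s≤s (filter-downFrom-below (tailℕ (match D)) c))
  by-shape : Shape → Decomposition (suc k) D
  by-shape (next-joins-left γ₂ γ₂≡ P-left) =
    composed-decomposition D A.D′ A.composition (grow-first-block tails-at-largest A.tails-opened A.heads-opened I<c+1)
      (decompose-lighter A.D′ (weight-grow tails-at-largest A.tails-opened (cong length A.heads-opened) (<⇒≤ c+1<m)))
    where module A = NextJoinsLeft γ₂ γ₂≡ P-left
  by-shape (all-vertical vertical) =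
    composed-decomposition D B.D′ B.composition (add-first-block tails-at-largest B.tails-opened B.heads-opened (≤-pred c+1<m) I<c+1 B.heads-opened-below)
      (decompose-lighter B.D′ (weight-add tails-at-largest B.tails-opened (cong length B.heads-opened)))
    where module B = AllVertical vertical

decompose : ∀ {n} N (D : Diagram (suc n)) → weight D < N → Decomposition n D
decompose zero D ()
decompose (suc N) D w<N+1 with largest-tail D
... | inj₁ no-tails = identity-decomposition D no-tails
decompose {zero}  (suc N) D _ | inj₂ (γ , γ-tail , _) = ⊥-elim (<⇒≱ γ-tail (≤-trans (≤-pred (index<m (match D (top γ)))) z≤n))
decompose {suc k} (suc N) D w<N+1 | inj₂ (γ , γ-tail , no-tail-after) =
  peel-largest-tail D γ γ-tail no-tail-after (λ D′ lighter → decompose N D′ (<-≤-trans lighter (≤-pred w<N+1)))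

decomposition : ∀ n (D : Diagram (suc n)) → Canonical n (Ilist D) (Jlist D) × (∀ x → match D x ≡ 𝒟 (canonWord (Ilist D) (Jlist D)) x)
decomposition n D = subst₂ (λ I J → Canonical n I J × (∀ x → match D x ≡ 𝒟 (canonWord I J) x)) (sym (Ilist≡ D)) (sym (Jlist≡ D))
                           (decompose (suc (weight D)) D ≤-refl)

mainTheorem3 : (n : ℕ) (D : Diagram (suc n)) →
    length (Ilist D) ≡ size D × length (Jlist D) ≡ size D
    × Pointwise _≤_ (Ilist D) (Jlist D)
    × FCWord n (canonWord (Ilist D) (Jlist D))
    × (∀ x → match D x ≡ 𝒟 (canonWord (Ilist D) (Jlist D)) x)
mainTheorem3 n D =
  length-Ilist D , trans (sym (Pointwise-length I≤J)) (length-Ilist D) , I≤J , canonWord-fullyCommutative canonical , D≗𝒟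
  where
  decomposed = decomposition n D
  canonical = proj₁ decomposed
  D≗𝒟 = proj₂ decomposed
  I≤J = Canonical⇒Pointwise≤ canonical
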